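{- Let $n \geq 2$, let $D=(d_1,\dots,d_n) \in [m]^n$ and $k \in [m]$. Then \[ p_{\textsc{Bins}(k)}(D) = \Theta\Big(\min\Big(1 , \frac{\|D\|_1^2 - \|D\|_2^2}{km} + \frac{n \|D\|_1}{m} + \frac{n^2 k}{m} \Big)\Big). \]
   Context: Fix $m\in\mathbb N$ and the universe of IDs $[m]=\{1,\dots,m\}$. An ID-generation algorithm $\mathcal A$ is a probability distribution over permutations of $[m]$: an instance of $\mathcal A$ draws a permutation and answers its $t$-th request with the $t$-th entry. A demand profile $D=(d_1,\dots,d_n)\in[m]^n$ means that $n$ instances of $\mathcal A$ with independent randomness are run and instance $i$ receives $d_i$ requests. A collision occurs if the sets of IDs output by the $n$ instances are not pairwise disjoint; $p_{\mathcal A}(D)$ is the collision probability. $\|D\|_1=\sum_i d_i$, $\|D\|_2^2=\sum_i d_i^2$. Algorithm $\textsc{Bins}(k)$: fix a partition of $[m]$ into $\lfloor m/k\rfloor$ bins of $k$ IDs each and $m \bmod k$ leftover IDs; pick a uniformly random permutation of the bins, iterate over the shuffled bins returning all IDs of a bin in increasing order before moving to the next bin, and finally return the leftover IDs in increasing order. Asymptotic notation is non-asymptotic: $f=O(g)$ means there is an absolute constant $c>0$, independent of all parameters, with $f\le c\,g$ always; $\Omega$ is the reverse and $\Theta$ means both. -}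

module Defs where

open import Data.Nat as ℕ using (ℕ; zero; suc; _≡ᵇ_; _/_; _%_)
open import Data.Bool using (Bool; true; false; not; _∧_)
open import Data.List using (List; []; _∷_; [_]; map; concatMap; _++_; take; upTo; length; filter)
open import Data.Bool.ListAction using (all; any)
open import Data.Nat.ListAction using (sum)
open import Data.Vec using (Vec; toList)
open import Data.Integer using (+_)
open import Data.Rational as ℚ using (ℚ; 0ℚ)
open import Relation.Nullary.Decidable using (yes; no)
open import Data.Bool using (T)
open import Data.Bool.Properties using (T?)

-- All permutations of a list (each arrangement listed exactly once
-- when the input has distinct entries).
insertAll : {A : Set} → A → List A → List (List A)
insertAll x [] = [ x ∷ [] ]
insertAll x (y ∷ ys) = (x ∷ y ∷ ys) ∷ map (y ∷_) (insertAll x ys)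

permutations : {A : Set} → List A → List (List A)
permutations [] = [ [] ]
permutations (x ∷ xs) = concatMap (insertAll x) (permutations xs)

-- An ID-generation algorithm over [m] given as a *uniform* distribution
-- over a finite list of output sequences (permutations of [m], written
-- as the list of IDs in the order they are returned).
UniformAlg : Set
UniformAlg = List (List ℕ)

-- The fixed partition uses
-- consecutive bins: bin b (b = 0,…,⌊m/k⌋-1) = {b·k+1, …, b·k+k};
-- leftover IDs are ⌊m/k⌋·k+1, …, m.
binsSequence : (m k : ℕ) → .{{_ : ℕ.NonZero k}} → List ℕ → List ℕ
binsSequence m k σ =
  concatMap (λ b → map (λ j → b ℕ.* k ℕ.+ j ℕ.+ 1) (upTo k)) σ
  ++ map (λ j → (m / k) ℕ.* k ℕ.+ j ℕ.+ 1) (upTo (m % k))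

Bins : (m k : ℕ) → .{{_ : ℕ.NonZero k}} → UniformAlg
Bins m k = map (binsSequence m k) (permutations (upTo (m / k)))

disjointᵇ : List ℕ → List ℕ → Bool
disjointᵇ xs ys = all (λ x → not (any (λ y → x ≡ᵇ y) ys)) xs

pairwiseDisjointᵇ : List (List ℕ) → Bool
pairwiseDisjointᵇ [] = true
pairwiseDisjointᵇ (xs ∷ xss) = all (disjointᵇ xs) xss ∧ pairwiseDisjointᵇ xss

-- All equally likely joint outcomes of running independent instances
-- of the algorithm with demands D: one output sequence chosen for each
-- instance, instance i outputting the first dᵢ entries.
runs : UniformAlg → List ℕ → List (List (List ℕ))
runs A [] = [ [] ]
runs A (d ∷ D) = concatMap (λ s → map (take d s ∷_) (runs A D)) A

collisionCount : UniformAlg → List ℕ → ℕ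
collisionCount A D = length (filter (λ o → T? (not (pairwiseDisjointᵇ o))) (runs A D))

-- a / b as a rational (0 if b = 0; only used with b ≠ 0)
frac : ℕ → ℕ → ℚ
frac a zero = 0ℚ
frac a (suc b) = (+ a) ℚ./ suc b

collisionProb : UniformAlg → {n : ℕ} → Vec ℕ n → ℚ
collisionProb A {n} D = frac (collisionCount A (toList D)) (length A ℕ.^ n)

norm1 : {n : ℕ} → Vec ℕ n → ℕ
norm1 D = sum (toList D)

norm2sq : {n : ℕ} → Vec ℕ n → ℕ
norm2sq D = sum (map (λ d → d ℕ.* d) (toList D))

-- Bins(k) hands out whole bins: with B = ⌊m/k⌋ bins, instance i opens the first aᵢ = min(⌈dᵢ/k⌉, B)
-- bins of its random bin order and reaches the leftover IDs only after opening every bin, so the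
-- instances collide exactly when two of them open a common bin.  Counting bin orders by falling
-- factorials gives W/(B + W) ≤ p ≤ W/B for W = Σ_{i<j} aᵢaⱼ.  Finally k²W ≤ km·X always, and
-- km·X ≤ 10k²W when W < B (then every dᵢ ≤ k·aᵢ), which gives p = Θ(min(1, X)) with constant 20.

module Submission where

open import Data.Nat using (ℕ)

module Counting where

  open import Data.Nat
  open import Data.Nat.Properties
  open import Data.Nat.ListAction using (sum)
  open import Data.Bool using (Bool; true; false; not; _∧_; _∨_)
  open import Data.Bool.Properties using (T?)
  open import Data.List using (List; []; _∷_; map; concatMap; _++_; length; filter)
  open import Data.List.Properties using (length-++)
  open import Data.List.Relation.Unary.All using (All; []; _∷_)
  open import Relation.Binary.PropositionalEquality
  open import Data.Nat.Tactic.RingSolver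

  private variable
    A B : Set

  𝟙 : Bool → ℕ
  𝟙 true = 1
  𝟙 false = 0

  𝟙-∧ : ∀ a b → 𝟙 (a ∧ b) ≡ 𝟙 a * 𝟙 b
  𝟙-∧ true b = sym (+-identityʳ (𝟙 b))
  𝟙-∧ false b = refl

  count : (A → Bool) → List A → ℕ
  count p [] = 0
  count p (x ∷ xs) = 𝟙 (p x) + count p xs

  length-filter : (p : A → Bool) (xs : List A) → length (filter (λ x → T? (p x)) xs) ≡ count p xs
  length-filter p [] = refl
  length-filter p (x ∷ xs) with p x
  ... | true = cong suc (length-filter p xs)
  ... | false = length-filter p xs

  count-++ : (p : A → Bool) (xs ys : List A) → count p (xs ++ ys) ≡ count p xs + count p ys
  count-++ p [] ys = refl
  count-++ p (x ∷ xs) ys = trans (cong (𝟙 (p x) +_) (count-++ p xs ys)) (sym (+-assoc (𝟙 (p x)) _ _))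

  count-concatMap : (p : B → Bool) (f : A → List B) (xs : List A) →
                    count p (concatMap f xs) ≡ sum (map (λ x → count p (f x)) xs)
  count-concatMap p f [] = refl
  count-concatMap p f (x ∷ xs) = trans (count-++ p (f x) (concatMap f xs)) (cong (count p (f x) +_) (count-concatMap p f xs))

  count-true : (xs : List A) → count (λ _ → true) xs ≡ length xs
  count-true [] = refl
  count-true (x ∷ xs) = cong suc (count-true xs)

  count-map : (p : B → Bool) (f : A → B) (xs : List A) → count p (map f xs) ≡ count (λ x → p (f x)) xs
  count-map p f [] = refl
  count-map p f (x ∷ xs) = cong (𝟙 (p (f x)) +_) (count-map p f xs)

  count-cong : {p q : A → Bool} → (∀ x → p x ≡ q x) → (xs : List A) → count p xs ≡ count q xs
  count-cong e [] = refl
  count-cong e (x ∷ xs) = cong₂ _+_ (cong 𝟙 (e x)) (count-cong e xs)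

  count-const-∧ : (b : Bool) (p : A → Bool) (xs : List A) → count (λ x → b ∧ p x) xs ≡ 𝟙 b * count p xs
  count-const-∧ true p xs = sym (+-identityʳ (count p xs))
  count-const-∧ false p [] = refl
  count-const-∧ false p (x ∷ xs) = count-const-∧ false p xs

  count-not+count : (p : A → Bool) (xs : List A) → count (λ x → not (p x)) xs + count p xs ≡ length xs
  count-not+count p [] = refl
  count-not+count p (x ∷ xs) with p x
  ... | true = trans (+-suc _ _) (cong suc (count-not+count p xs))
  ... | false = cong suc (count-not+count p xs)

  count≤length : (p : A → Bool) (xs : List A) → count p xs ≤ length xs
  count≤length p [] = z≤n
  count≤length p (x ∷ xs) with p x
  ... | true = s≤s (count≤length p xs)
  ... | false = m≤n⇒m≤1+n (count≤length p xs)

  count≡0 : {p : A → Bool} {xs : List A} → All (λ x → p x ≡ false) xs → count p xs ≡ 0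
  count≡0 [] = refl
  count≡0 (e ∷ es) rewrite e = count≡0 es

  count-∨ : (p q : A → Bool) (xs : List A) → (∀ y → p y ≡ true → q y ≡ false) →
            count (λ y → p y ∨ q y) xs ≡ count p xs + count q xs
  count-∨ p q [] h = refl
  count-∨ p q (x ∷ xs) h with p x in e
  ... | true rewrite h x e = cong suc (count-∨ p q xs h)
  ... | false = trans (cong (𝟙 (q x) +_) (count-∨ p q xs h)) (swap (𝟙 (q x)) (count p xs) (count q xs))
    where
    swap : ∀ a b c → a + (b + c) ≡ b + (a + c)
    swap = solve-∀

  length-concatMap : (f : A → List B) (xs : List A) → length (concatMap f xs) ≡ sum (map (λ x → length (f x)) xs)
  length-concatMap f [] = refl
  length-concatMap f (x ∷ xs) = trans (length-++ (f x)) (cong (length (f x) +_) (length-concatMap f xs))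

  sum-map-const : (c : ℕ) (xs : List A) → sum (map (λ _ → c) xs) ≡ length xs * c
  sum-map-const c [] = refl
  sum-map-const c (x ∷ xs) = cong (c +_) (sum-map-const c xs)

  sum-map-𝟙* : (p : A → Bool) (c : ℕ) (xs : List A) → sum (map (λ x → 𝟙 (p x) * c) xs) ≡ count p xs * c
  sum-map-𝟙* p c [] = refl
  sum-map-𝟙* p c (x ∷ xs) = trans (cong (𝟙 (p x) * c +_) (sum-map-𝟙* p c xs)) (sym (*-distribʳ-+ c (𝟙 (p x)) (count p xs)))

  sum-map-𝟙-linear : (p q : A → Bool) (a b : ℕ) (xs : List A) →
                     sum (map (λ x → a * 𝟙 (p x) + b * 𝟙 (q x)) xs) ≡ a * count p xs + b * count q xs
  sum-map-𝟙-linear p q a b [] = sym (cong₂ _+_ (*-zeroʳ a) (*-zeroʳ b))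
  sum-map-𝟙-linear p q a b (x ∷ xs) =
    trans (cong (a * 𝟙 (p x) + b * 𝟙 (q x) +_) (sum-map-𝟙-linear p q a b xs))
          (regroup a b (𝟙 (p x)) (𝟙 (q x)) (count p xs) (count q xs))
    where
    regroup : ∀ a b u v s t → a * u + b * v + (a * s + b * t) ≡ a * (u + s) + b * (v + t)
    regroup = solve-∀


module FallingFactorial where

  open import Data.Nat
  open import Data.Nat.Properties
  open import Data.Sum using (inj₁; inj₂)
  open import Relation.Nullary using (yes; no)
  open import Relation.Binary.PropositionalEquality
  open import Data.Nat.Tactic.RingSolver

  fall : ℕ → ℕ → ℕ
  fall M zero = 1
  fall M (suc a) = fall M a * (M ∸ a)

  fall≡0 : ∀ M a → M < a → fall M a ≡ 0
  fall≡0 M (suc a) M<1+a with m≤n⇒m<n∨m≡n (s≤s⁻¹ M<1+a)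
  ... | inj₁ M<a rewrite fall≡0 M a M<a = refl
  ... | inj₂ refl rewrite n∸n≡0 M = *-zeroʳ (fall M M)

  fall-pascal : ∀ M a → fall (suc M) (suc a) ≡ suc a * fall M a + fall M (suc a)
  fall-pascal M zero = cong suc (trans (+-identityʳ M) (sym (+-identityʳ M)))
  fall-pascal M (suc a) = trans (cong (_* (M ∸ a)) (fall-pascal M a))
    (step a (fall M a) (M ∸ a) (M ∸ suc a) (sym (pred[m∸n]≡m∸[1+n] M a)))
    where
    step : ∀ a F t t' → t' ≡ pred t → (suc a * F + F * t) * t ≡ suc (suc a) * (F * t) + F * t * t'
    step a F zero t' _ = identity a F t'
      where
      identity : ∀ a F t' → (suc a * F + F * 0) * 0 ≡ suc (suc a) * (F * 0) + F * 0 * t'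
      identity = solve-∀
    step a F (suc t) .t refl = identity a F t
      where
      identity : ∀ a F t → (suc a * F + F * suc t) * suc t ≡ suc (suc a) * (F * suc t) + F * suc t * t
      identity = solve-∀

  fall-monoˡ-≤ : ∀ {M M'} a → M ≤ M' → fall M a ≤ fall M' a
  fall-monoˡ-≤ zero _ = ≤-refl
  fall-monoˡ-≤ (suc a) M≤M' = *-mono-≤ (fall-monoˡ-≤ a M≤M') (∸-monoˡ-≤ a M≤M')

  fall-suc : ∀ M a → fall (suc M) (suc a) ≡ suc M * fall M a
  fall-suc M zero = *-comm 1 (suc M)
  fall-suc M (suc a) = begin
    fall (suc M) (suc a) * (M ∸ a) ≡⟨ cong (_* (M ∸ a)) (fall-suc M a) ⟩
    suc M * fall M a * (M ∸ a)     ≡⟨ *-assoc (suc M) (fall M a) (M ∸ a) ⟩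
    suc M * (fall M a * (M ∸ a))   ∎
    where open ≡-Reasoning

  fall*!≡! : ∀ M a → a ≤ M → fall M a * (M ∸ a) ! ≡ M !
  fall*!≡! M zero _ = +-identityʳ (M !)
  fall*!≡! M (suc a) 1+a≤M = begin
    fall M a * (M ∸ a) * (M ∸ suc a) !   ≡⟨ *-assoc (fall M a) (M ∸ a) _ ⟩
    fall M a * ((M ∸ a) * (M ∸ suc a) !) ≡⟨ cong (fall M a *_) peel ⟩
    fall M a * (M ∸ a) !                 ≡⟨ fall*!≡! M a (≤-trans (n≤1+n a) 1+a≤M) ⟩
    M !                                  ∎
    where
    open ≡-Reasoning
    peel : (M ∸ a) * (M ∸ suc a) ! ≡ (M ∸ a) !
    peel rewrite +-∸-assoc 1 1+a≤M = refl

  private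
    lowerBound-suc : ∀ M a u → fall (suc M) (suc a) ≤ fall (suc M ∸ u) (suc a) + u * suc a * fall M a
    lowerBound-suc M a zero = m≤m+n _ 0
    lowerBound-suc M a (suc u) with u ≤? M
    ... | no u≰M = ≤-trans (lowerBound-suc M a u)
            (+-mono-≤ (≤-reflexive (cong (λ v → fall v (suc a)) (trans (m≤n⇒m∸n≡0 M<u) (sym (m≤n⇒m∸n≡0 (<⇒≤ M<u))))))
                      (*-monoˡ-≤ (fall M a) (*-monoˡ-≤ (suc a) (n≤1+n u))))
      where
      M<u = ≰⇒> u≰M
    ... | yes u≤M = ≤-trans (lowerBound-suc M a u) step
      where
      absorb : ∀ x y z w → y ≤ w → suc x * y + z + u * suc x * w ≤ z + suc u * suc x * w
      absorb x y z w y≤w = ≤-trans (+-monoˡ-≤ (u * suc x * w) (+-monoˡ-≤ z (*-monoʳ-≤ (suc x) y≤w)))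
                                   (≤-reflexive (regroup u x z w))
        where
        regroup : ∀ u x z w → suc x * w + z + u * suc x * w ≡ z + suc u * suc x * w
        regroup = solve-∀
      step : fall (suc M ∸ u) (suc a) + u * suc a * fall M a ≤ fall (M ∸ u) (suc a) + suc u * suc a * fall M a
      step rewrite +-∸-assoc 1 u≤M | fall-pascal (M ∸ u) a =
        absorb a (fall (M ∸ u) a) (fall (M ∸ u) (suc a)) (fall M a) (fall-monoˡ-≤ a (m∸n≤m M u))

  -- Union bound: an injective a-sequence from B items meets a given u-set in at most a·u·(B−1)_(a−1) ways.
  fall-∸-lowerBound : ∀ B a u → B * fall B a ≤ B * fall (B ∸ u) a + a * u * fall B a
  fall-∸-lowerBound zero a u = z≤n
  fall-∸-lowerBound (suc M) zero u = m≤m+n _ _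
  fall-∸-lowerBound (suc M) (suc a) u = ≤-trans (*-monoʳ-≤ (suc M) (lowerBound-suc M a u)) (≤-reflexive eq)
    where
    eq : suc M * (fall (suc M ∸ u) (suc a) + u * suc a * fall M a) ≡ suc M * fall (suc M ∸ u) (suc a) + suc a * u * fall (suc M) (suc a)
    eq rewrite fall-suc M a = regroup (suc M) (fall (suc M ∸ u) (suc a)) u (suc a) (fall M a)
      where
      regroup : ∀ b x u a g → b * (x + u * a * g) ≡ b * x + a * u * (b * g)
      regroup = solve-∀

  private
    upperBound-factor : ∀ B u a → ((B ∸ u) ∸ a) * (B + suc a * u) ≤ (B ∸ a) * (B + a * u)
    upperBound-factor B u a with u + a ≤? B
    ... | no u+a≰B rewrite ∸-+-assoc B u a | m≤n⇒m∸n≡0 (<⇒≤ (≰⇒> u+a≰B)) = z≤n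
    ... | yes u+a≤B = subst (λ B → ((B ∸ u) ∸ a) * (B + suc a * u) ≤ (B ∸ a) * (B + a * u)) (m+[n∸m]≡n u+a≤B) main
      where
      z = B ∸ (u + a)
      cancel-u-a : (u + a + z) ∸ u ∸ a ≡ z
      cancel-u-a = trans (cong (_∸ a) (trans (cong (_∸ u) (+-assoc u a z)) (m+n∸m≡n u (a + z)))) (m+n∸m≡n a z)
      cancel-a : (u + a + z) ∸ a ≡ u + z
      cancel-a = trans (cong (_∸ a) (trans (cong (_+ z) (+-comm u a)) (+-assoc a u z))) (m+n∸m≡n a (u + z))
      slack : ∀ u a z → z * (u + a + z + suc a * u) + u * (u + a + a * u) ≡ (u + z) * (u + a + z + a * u)
      slack = solve-∀
      main : ((u + a + z) ∸ u ∸ a) * (u + a + z + suc a * u) ≤ ((u + a + z) ∸ a) * (u + a + z + a * u)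
      main rewrite cancel-u-a | cancel-a = m+n≤o⇒m≤o _ (≤-reflexive (slack u a z))

  -- Proved factor by factor: (B−u−a)(B+(a+1)u) ≤ (B−a)(B+au).
  fall-∸-upperBound : ∀ B u a → fall (B ∸ u) a * (B + a * u) ≤ B * fall B a
  fall-∸-upperBound B u zero = ≤-reflexive (trans (+-identityʳ _) (trans (+-identityʳ B) (sym (*-identityʳ B))))
  fall-∸-upperBound B u (suc a) = begin
    fall (B ∸ u) a * ((B ∸ u) ∸ a) * (B + suc a * u)   ≡⟨ *-assoc (fall (B ∸ u) a) _ _ ⟩
    fall (B ∸ u) a * (((B ∸ u) ∸ a) * (B + suc a * u)) ≤⟨ *-monoʳ-≤ (fall (B ∸ u) a) (upperBound-factor B u a) ⟩
    fall (B ∸ u) a * ((B ∸ a) * (B + a * u))           ≡⟨ exchange (fall (B ∸ u) a) (B ∸ a) (B + a * u) ⟩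
    (B ∸ a) * (fall (B ∸ u) a * (B + a * u))           ≤⟨ *-monoʳ-≤ (B ∸ a) (fall-∸-upperBound B u a) ⟩
    (B ∸ a) * (B * fall B a)                           ≡⟨ exchange′ (B ∸ a) B (fall B a) ⟩
    B * (fall B a * (B ∸ a))                           ∎
    where
    open ≤-Reasoning
    exchange : ∀ x y z → x * (y * z) ≡ y * (x * z)
    exchange = solve-∀
    exchange′ : ∀ x y z → x * (y * z) ≡ y * (z * x)
    exchange′ = solve-∀


module Permutations where

  open import Data.Nat
  open import Data.Nat.Properties
  open import Data.Nat.ListAction using (sum)
  open import Data.Bool using (Bool; true; false; not; _∧_)
  open import Data.Bool.Properties using (∧-identityʳ)
  open import Data.Bool.ListAction using (all)
  open import Data.List using (List; []; _∷_; map; concatMap; take; length; upTo)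
  open import Data.List.Properties using (length-map; length-upTo; map-cong-local)
  open import Data.List.Relation.Unary.All as All using (All; []; _∷_)
  open import Data.List.Relation.Unary.All.Properties using (map⁺; concat⁺)
  open import Data.List.Membership.Propositional using (_∈_)
  open import Data.List.Membership.Propositional.Properties using (∈-upTo⁻; ∈-upTo⁺)
  open import Data.List.Relation.Unary.Unique.Propositional using (Unique)
  open import Data.List.Relation.Unary.Unique.Propositional.Properties using (upTo⁺)
  open import Data.List.Relation.Binary.Permutation.Propositional using (_↭_; ↭-refl; ↭-trans; ↭-sym; prep; swap; ↭⇒↭ₛ)
  open import Data.List.Relation.Binary.Permutation.Propositional.Properties using (∈-resp-↭; ↭-length)
  import Data.List.Relation.Binary.Permutation.Setoid.Properties as SetoidPermutation
  open import Data.Sum using (inj₁; inj₂)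
  open import Relation.Binary.PropositionalEquality hiding ([_])
  open import Data.Nat.Tactic.RingSolver
  open import Defs using (insertAll; permutations)
  open Counting
  open FallingFactorial

  All-concatMap : {A B : Set} {P : B → Set} (f : A → List B) (xs : List A) →
                  All (λ x → All P (f x)) xs → All P (concatMap f xs)
  All-concatMap f xs ps = concat⁺ (map⁺ ps)

  insertAll-↭ : ∀ (x : ℕ) τ → All (λ σ → σ ↭ x ∷ τ) (insertAll x τ)
  insertAll-↭ x [] = ↭-refl ∷ []
  insertAll-↭ x (y ∷ τ) = ↭-refl ∷ map⁺ (All.map (λ p → ↭-trans (prep y p) (swap y x ↭-refl)) (insertAll-↭ x τ))

  permutations-↭ : ∀ (L : List ℕ) → All (_↭ L) (permutations L)
  permutations-↭ [] = ↭-refl ∷ []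
  permutations-↭ (x ∷ xs) = All-concatMap (insertAll x) (permutations xs)
    (All.map (λ p → All.map (λ q → ↭-trans q (prep x p)) (insertAll-↭ x _)) (permutations-↭ xs))

  length-insertAll : (x : ℕ) (τ : List ℕ) → length (insertAll x τ) ≡ suc (length τ)
  length-insertAll x [] = refl
  length-insertAll x (y ∷ τ) = cong suc (trans (length-map (y ∷_) (insertAll x τ)) (length-insertAll x τ))

  length-permutations : (L : List ℕ) → length (permutations L) ≡ length L !
  length-permutations [] = refl
  length-permutations (x ∷ xs) = begin
    length (concatMap (insertAll x) (permutations xs))           ≡⟨ length-concatMap (insertAll x) (permutations xs) ⟩
    sum (map (λ τ → length (insertAll x τ)) (permutations xs))  ≡⟨ cong sum (map-cong-local (All.map length-insert (permutations-↭ xs))) ⟩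
    sum (map (λ _ → suc (length xs)) (permutations xs))         ≡⟨ sum-map-const (suc (length xs)) (permutations xs) ⟩
    length (permutations xs) * suc (length xs)                  ≡⟨ cong (_* suc (length xs)) (length-permutations xs) ⟩
    length xs ! * suc (length xs)                               ≡⟨ *-comm (length xs !) _ ⟩
    suc (length xs) !                                           ∎
    where
    open ≡-Reasoning
    length-insert : ∀ {τ} → τ ↭ xs → length (insertAll x τ) ≡ suc (length xs)
    length-insert {τ} τ↭xs = trans (length-insertAll x τ) (cong suc (↭-length τ↭xs))

  record IsPermutationOfUpTo (B : ℕ) (σ : List ℕ) : Set where
    field
      length≡ : length σ ≡ B
      ∈⇒<     : ∀ {b} → b ∈ σ → b < B
      <⇒∈     : ∀ {b} → b < B → b ∈ σ
      unique  : Unique σ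

  permutations-upTo : ∀ B → All (IsPermutationOfUpTo B) (permutations (upTo B))
  permutations-upTo B = All.map (λ σ↭ → record
    { length≡ = trans (↭-length σ↭) (length-upTo B)
    ; ∈⇒<     = λ b∈σ → ∈-upTo⁻ (∈-resp-↭ σ↭ b∈σ)
    ; <⇒∈     = λ b<B → ∈-resp-↭ (↭-sym σ↭) (∈-upTo⁺ b<B)
    ; unique  = SetoidPermutation.Unique-resp-↭ (setoid ℕ) (↭⇒↭ₛ (↭-sym σ↭)) (upTo⁺ B)
    }) (permutations-↭ (upTo B))

  module PrefixCount (q : ℕ → Bool) where

    prefixAll : ℕ → List ℕ → Bool
    prefixAll a σ = all q (take a σ)

    prefixAll-[] : ∀ a → prefixAll a [] ≡ true
    prefixAll-[] zero = refl
    prefixAll-[] (suc a) = refl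

    -- x lands inside the first a positions in min(a, |τ|+1) of the |τ|+1 insertions.
    count-prefixAll-insertAll : ∀ x τ a →
      count (prefixAll a) (insertAll x τ)
        ≡ 𝟙 (q x) * (a ⊓ suc (length τ)) * 𝟙 (prefixAll (a ∸ 1) τ) + (suc (length τ) ∸ a) * 𝟙 (prefixAll a τ)
    count-prefixAll-insertAll x τ zero = begin
      count (λ _ → true) (insertAll x τ)                    ≡⟨ count-true (insertAll x τ) ⟩
      length (insertAll x τ)                                ≡⟨ length-insertAll x τ ⟩
      suc (length τ)                                        ≡⟨ pad (𝟙 (q x)) (length τ) ⟩
      𝟙 (q x) * 0 * 1 + suc (length τ) * 1                  ∎
      where
      open ≡-Reasoning
      pad : ∀ b L → suc L ≡ b * 0 * 1 + suc L * 1
      pad = solve-∀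
    count-prefixAll-insertAll x [] (suc a) rewrite prefixAll-[] a | ∧-identityʳ (q x) | ⊓-zeroʳ a | 0∸n≡0 a = pad (𝟙 (q x))
      where
      pad : ∀ b → b + 0 ≡ b * 1 * 1 + 0 * 1
      pad = solve-∀
    count-prefixAll-insertAll x (y ∷ τ) (suc a) = begin
      𝟙 (q x ∧ prefixAll a (y ∷ τ)) + count (prefixAll (suc a)) (map (y ∷_) (insertAll x τ))
        ≡⟨ cong (𝟙 (q x ∧ prefixAll a (y ∷ τ)) +_) (trans (count-map (prefixAll (suc a)) (y ∷_) (insertAll x τ))
                                                          (count-const-∧ (q y) (prefixAll a) (insertAll x τ))) ⟩
      𝟙 (q x ∧ prefixAll a (y ∷ τ)) + 𝟙 (q y) * count (prefixAll a) (insertAll x τ)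
        ≡⟨ cong (λ c → 𝟙 (q x ∧ prefixAll a (y ∷ τ)) + 𝟙 (q y) * c) (count-prefixAll-insertAll x τ a) ⟩
      𝟙 (q x ∧ prefixAll a (y ∷ τ)) + 𝟙 (q y) * (𝟙 (q x) * (a ⊓ suc L) * 𝟙 (prefixAll (a ∸ 1) τ) + (suc L ∸ a) * 𝟙 (prefixAll a τ))
        ≡⟨ step a ⟩
      𝟙 (q x) * suc (a ⊓ suc L) * 𝟙 (prefixAll a (y ∷ τ)) + (suc L ∸ a) * 𝟙 (q y ∧ prefixAll a τ)
        ∎
      where
      open ≡-Reasoning
      L = length τ
      step : ∀ a → 𝟙 (q x ∧ prefixAll a (y ∷ τ))
                     + 𝟙 (q y) * (𝟙 (q x) * (a ⊓ suc L) * 𝟙 (prefixAll (a ∸ 1) τ) + (suc L ∸ a) * 𝟙 (prefixAll a τ))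
                 ≡ 𝟙 (q x) * suc (a ⊓ suc L) * 𝟙 (prefixAll a (y ∷ τ)) + (suc L ∸ a) * 𝟙 (q y ∧ prefixAll a τ)
      step zero rewrite ∧-identityʳ (q x) | 𝟙-∧ (q y) (prefixAll 0 τ) = identity (𝟙 (q x)) (𝟙 (q y)) L
        where
        identity : ∀ b c L → b + c * (b * 0 * 1 + suc L * 1) ≡ b * 1 * 1 + suc L * (c * 1)
        identity = solve-∀
      step (suc a) rewrite 𝟙-∧ (q x) (q y ∧ prefixAll a τ) | 𝟙-∧ (q y) (prefixAll a τ) | 𝟙-∧ (q y) (prefixAll (suc a) τ) =
        identity (𝟙 (q x)) (𝟙 (q y)) (𝟙 (prefixAll a τ)) (𝟙 (prefixAll (suc a) τ)) (a ⊓ L) (L ∸ a)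
        where
        identity : ∀ b c t u M w → b * (c * t) + c * (b * suc M * t + w * u) ≡ b * suc (suc M) * (c * t) + w * (c * u)
        identity = solve-∀

    countPrefixAll : List ℕ → ℕ → ℕ
    countPrefixAll L a = count (prefixAll a) (permutations L)

    countPrefixAll-∷ : ∀ x xs a → countPrefixAll (x ∷ xs) a
      ≡ 𝟙 (q x) * (a ⊓ suc (length xs)) * countPrefixAll xs (a ∸ 1) + (suc (length xs) ∸ a) * countPrefixAll xs a
    countPrefixAll-∷ x xs a = begin
      count (prefixAll a) (concatMap (insertAll x) (permutations xs))
        ≡⟨ count-concatMap (prefixAll a) (insertAll x) (permutations xs) ⟩
      sum (map (λ τ → count (prefixAll a) (insertAll x τ)) (permutations xs))
        ≡⟨ cong sum (map-cong-local (All.map insert (permutations-↭ xs))) ⟩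
      sum (map (λ τ → α * 𝟙 (prefixAll (a ∸ 1) τ) + β * 𝟙 (prefixAll a τ)) (permutations xs))
        ≡⟨ sum-map-𝟙-linear (prefixAll (a ∸ 1)) (prefixAll a) α β (permutations xs) ⟩
      α * countPrefixAll xs (a ∸ 1) + β * countPrefixAll xs a
        ∎
      where
      open ≡-Reasoning
      N = length xs
      α = 𝟙 (q x) * (a ⊓ suc N)
      β = suc N ∸ a
      insert : ∀ {τ} → τ ↭ xs → count (prefixAll a) (insertAll x τ) ≡ α * 𝟙 (prefixAll (a ∸ 1) τ) + β * 𝟙 (prefixAll a τ)
      insert {τ} τ↭xs rewrite sym (↭-length τ↭xs) = count-prefixAll-insertAll x τ a

    forbidden : List ℕ → ℕ
    forbidden L = count (λ y → not (q y)) L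

    private module ClosedForm (xs : List ℕ) where
      N = length xs
      u = forbidden xs
      u≤N : u ≤ N
      u≤N = count≤length (λ y → not (q y)) xs

      closed-form-∷ : (∀ a → a ≤ N → countPrefixAll xs a ≡ fall (N ∸ u) a * (N ∸ a) !) → ∀ b a → a ≤ suc N →
        𝟙 b * (a ⊓ suc N) * countPrefixAll xs (a ∸ 1) + (suc N ∸ a) * countPrefixAll xs a
          ≡ fall (suc N ∸ (𝟙 (not b) + u)) a * (suc N ∸ a) !
      closed-form-∷ ih false a a≤ with m≤n⇒m<n∨m≡n a≤
      ... | inj₁ (s≤s a≤N) rewrite +-∸-assoc 1 a≤N | ih a a≤N =
        identity (a ⊓ suc N) (countPrefixAll xs (a ∸ 1)) (fall (N ∸ u) a) (N ∸ a) ((N ∸ a) !)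
        where
        identity : ∀ z c F w W → 0 * z * c + suc w * (F * W) ≡ F * (W + w * W)
        identity = solve-∀
      ... | inj₂ refl rewrite n∸n≡0 N | fall≡0 (N ∸ u) (suc N) (s≤s (m∸n≤m N u)) = refl
      closed-form-∷ ih true zero _ rewrite ih 0 z≤n = identity N (N !)
        where
        identity : ∀ N W → 1 * 0 * 1 + suc N * (1 * W) ≡ 1 * (W + N * W)
        identity = solve-∀
      closed-form-∷ ih true (suc a) (s≤s a≤N) with m≤n⇒m<n∨m≡n a≤N
      ... | inj₁ a<N rewrite m≤n⇒m⊓n≡m (<⇒≤ a<N) | ih a (<⇒≤ a<N) | ih (suc a) a<N | +-∸-assoc 1 u≤N
                           | fall-pascal (N ∸ u) a | +-∸-assoc 1 a<N =
        identity a (fall (N ∸ u) a) (fall (N ∸ u) (suc a)) (N ∸ suc a) ((N ∸ suc a) !)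
        where
        identity : ∀ a F G w W → 1 * suc a * (F * (W + w * W)) + suc w * (G * W) ≡ (suc a * F + G) * (W + w * W)
        identity = solve-∀
      ... | inj₂ refl rewrite ⊓-idem N | n∸n≡0 N | ih N ≤-refl | n∸n≡0 N | +-∸-assoc 1 u≤N
                            | fall-pascal (N ∸ u) N | fall≡0 (N ∸ u) (suc N) (s≤s (m∸n≤m N u)) =
        identity N (fall (N ∸ u) N) (countPrefixAll xs (suc N))
        where
        identity : ∀ N F c → 1 * suc N * (F * 1) + 0 * c ≡ (suc N * F + 0) * 1
        identity = solve-∀

    countPrefixAll≡ : ∀ L a → a ≤ length L → countPrefixAll L a ≡ fall (length L ∸ forbidden L) a * (length L ∸ a) !
    countPrefixAll≡ [] zero _ = refl
    countPrefixAll≡ (x ∷ xs) a a≤ = trans (countPrefixAll-∷ x xs a) (ClosedForm.closed-form-∷ xs (countPrefixAll≡ xs) (q x) a a≤)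


module CrossSum where

  open import Data.Nat
  open import Data.Nat.Properties
  open import Data.Nat.ListAction using (sum)
  open import Data.List using (List; []; _∷_; map; length)
  open import Data.List.Relation.Unary.All as All using (All; []; _∷_)
  open import Data.List.Relation.Binary.Pointwise using (Pointwise; []; _∷_)
  open import Relation.Binary.PropositionalEquality
  open import Data.Nat.Tactic.RingSolver

  -- crossSum 0 as = Σ_{i<j} aᵢ aⱼ; in general the offset u plays the role of a zeroth entry.
  crossSum : ℕ → List ℕ → ℕ
  crossSum u [] = 0
  crossSum u (a ∷ as) = a * u + crossSum (u + a) as

  sumOfSquares : List ℕ → ℕ
  sumOfSquares ds = sum (map (λ d → d * d) ds)

  crossSum-+ : ∀ u v as → crossSum (u + v) as ≡ v * sum as + crossSum u as
  crossSum-+ u v [] = sym (trans (+-identityʳ (v * 0)) (*-zeroʳ v))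
  crossSum-+ u v (a ∷ as) = begin
    a * (u + v) + crossSum (u + v + a) as            ≡⟨ cong (λ z → a * (u + v) + crossSum z as) (swap u v a) ⟩
    a * (u + v) + crossSum (u + a + v) as            ≡⟨ cong (a * (u + v) +_) (crossSum-+ (u + a) v as) ⟩
    a * (u + v) + (v * sum as + crossSum (u + a) as) ≡⟨ regroup a u v (sum as) (crossSum (u + a) as) ⟩
    v * (a + sum as) + (a * u + crossSum (u + a) as) ∎
    where
    open ≡-Reasoning
    swap : ∀ u v a → u + v + a ≡ u + a + v
    swap = solve-∀
    regroup : ∀ a u v s w → a * (u + v) + (v * s + w) ≡ v * (a + s) + (a * u + w)
    regroup = solve-∀

  crossSum-mono : ∀ {xs ys u v} → Pointwise _≤_ xs ys → u ≤ v → crossSum u xs ≤ crossSum v ys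
  crossSum-mono [] _ = z≤n
  crossSum-mono (x≤y ∷ xs≤ys) u≤v = +-mono-≤ (*-mono-≤ x≤y u≤v) (crossSum-mono xs≤ys (+-mono-≤ u≤v x≤y))

  crossSum-scale : ∀ c u as → crossSum (c * u) (map (c *_) as) ≡ c * c * crossSum u as
  crossSum-scale c u [] = sym (*-zeroʳ (c * c))
  crossSum-scale c u (a ∷ as) = begin
    c * a * (c * u) + crossSum (c * u + c * a) (map (c *_) as) ≡⟨ cong (λ z → c * a * (c * u) + crossSum z (map (c *_) as)) (sym (*-distribˡ-+ c u a)) ⟩
    c * a * (c * u) + crossSum (c * (u + a)) (map (c *_) as)   ≡⟨ cong (c * a * (c * u) +_) (crossSum-scale c (u + a) as) ⟩
    c * a * (c * u) + c * c * crossSum (u + a) as              ≡⟨ regroup c a u (crossSum (u + a) as) ⟩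
    c * c * (a * u + crossSum (u + a) as)                      ∎
    where
    open ≡-Reasoning
    regroup : ∀ c a u w → c * a * (c * u) + c * c * w ≡ c * c * (a * u + w)
    regroup = solve-∀

  square-sum : ∀ u ds → (u + sum ds) * (u + sum ds) ≡ u * u + sumOfSquares ds + 2 * crossSum u ds
  square-sum u [] = base u
    where
    base : ∀ u → (u + 0) * (u + 0) ≡ u * u + 0 + 2 * 0
    base = solve-∀
  square-sum u (d ∷ ds) = begin
    (u + (d + sum ds)) * (u + (d + sum ds))                               ≡⟨ cong (λ z → z * z) (sym (+-assoc u d (sum ds))) ⟩
    (u + d + sum ds) * (u + d + sum ds)                                   ≡⟨ square-sum (u + d) ds ⟩
    (u + d) * (u + d) + sumOfSquares ds + 2 * crossSum (u + d) ds         ≡⟨ expand u d (sumOfSquares ds) (crossSum (u + d) ds) ⟩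
    u * u + (d * d + sumOfSquares ds) + 2 * (d * u + crossSum (u + d) ds) ∎
    where
    open ≡-Reasoning
    expand : ∀ u d s w → (u + d) * (u + d) + s + 2 * w ≡ u * u + (d * d + s) + 2 * (d * u + w)
    expand = solve-∀

  sum-map-+ : ∀ c ds → sum (map (_+ c) ds) ≡ sum ds + length ds * c
  sum-map-+ c [] = refl
  sum-map-+ c (d ∷ ds) = trans (cong (d + c +_) (sum-map-+ c ds)) (regroup d c (sum ds) (length ds * c))
    where
    regroup : ∀ d c s t → d + c + (s + t) ≡ d + s + (c + t)
    regroup = solve-∀

  sum-map-*ˡ : ∀ c as → sum (map (c *_) as) ≡ c * sum as
  sum-map-*ˡ c [] = sym (*-zeroʳ c)
  sum-map-*ˡ c (a ∷ as) = trans (cong (c * a +_) (sum-map-*ˡ c as)) (sym (*-distribˡ-+ c a (sum as)))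

  sumOfSquares-map-+ : ∀ c ds → sumOfSquares ds ≤ sumOfSquares (map (_+ c) ds)
  sumOfSquares-map-+ c [] = z≤n
  sumOfSquares-map-+ c (d ∷ ds) = +-mono-≤ (*-mono-≤ (m≤m+n d c) (m≤m+n d c)) (sumOfSquares-map-+ c ds)

  sum-mono : ∀ {xs ys} → Pointwise _≤_ xs ys → sum xs ≤ sum ys
  sum-mono [] = z≤n
  sum-mono (x≤y ∷ xs≤ys) = +-mono-≤ x≤y (sum-mono xs≤ys)

  length≤sum : ∀ as → All (1 ≤_) as → length as ≤ sum as
  length≤sum [] [] = z≤n
  length≤sum (a ∷ as) (1≤a ∷ 1≤as) = +-mono-≤ 1≤a (length≤sum as 1≤as)

  All-≤-sum : ∀ as → All (_≤ sum as) as
  All-≤-sum [] = []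
  All-≤-sum (a ∷ as) = m≤m+n a (sum as) ∷ All.map (λ p → ≤-trans p (m≤n+m (sum as) a)) (All-≤-sum as)

  crossSum-∷ : ∀ a as → crossSum 0 (a ∷ as) ≡ a * sum as + crossSum 0 as
  crossSum-∷ a as = trans (cong (_+ crossSum a as) (*-zeroʳ a)) (crossSum-+ 0 a as)

  All-≤-crossSum : ∀ as → All (1 ≤_) as → 2 ≤ length as → All (_≤ crossSum 0 as) as
  All-≤-crossSum (_ ∷ []) _ (s≤s ())
  All-≤-crossSum (a₀ ∷ a₁ ∷ as) (1≤a₀ ∷ 1≤a₁ ∷ _) _ =
    ≤-trans a₀≤a₀S a₀S≤W ∷ All.map (λ p → ≤-trans p (≤-trans S≤a₀S a₀S≤W)) (All-≤-sum (a₁ ∷ as))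
    where
    S = a₁ + sum as
    a₀S≤W : a₀ * S ≤ crossSum 0 (a₀ ∷ a₁ ∷ as)
    a₀S≤W = ≤-trans (m≤m+n (a₀ * S) _) (≤-reflexive (sym (crossSum-∷ a₀ (a₁ ∷ as))))
    a₀≤a₀S : a₀ ≤ a₀ * S
    a₀≤a₀S = ≤-trans (≤-reflexive (sym (*-identityʳ a₀))) (*-monoʳ-≤ a₀ (≤-trans 1≤a₁ (m≤m+n a₁ (sum as))))
    S≤a₀S : S ≤ a₀ * S
    S≤a₀S = ≤-trans (≤-reflexive (sym (*-identityˡ S))) (*-monoˡ-≤ S 1≤a₀)

  [length∸1]*sum≤2*crossSum : ∀ as → All (1 ≤_) as → (length as ∸ 1) * sum as ≤ 2 * crossSum 0 as
  [length∸1]*sum≤2*crossSum [] [] = z≤n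
  [length∸1]*sum≤2*crossSum (a ∷ as) (1≤a ∷ 1≤as) =
    ≤-trans (step (length as) (length≤sum as 1≤as) ([length∸1]*sum≤2*crossSum as 1≤as))
            (≤-reflexive (cong (2 *_) (sym (crossSum-∷ a as))))
    where
    S = sum as
    step : ∀ L → L ≤ S → (L ∸ 1) * S ≤ 2 * crossSum 0 as → L * (a + S) ≤ 2 * (a * S + crossSum 0 as)
    step zero _ _ = z≤n
    step (suc l) L≤S ih = begin
      suc l * (a + S)                        ≡⟨ expand l a S ⟩
      suc l * a + S + l * S                  ≤⟨ +-monoʳ-≤ (suc l * a + S) ih ⟩
      suc l * a + S + 2 * crossSum 0 as      ≤⟨ +-monoˡ-≤ (2 * crossSum 0 as) (+-mono-≤ (*-monoˡ-≤ a L≤S) S≤aS) ⟩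
      S * a + a * S + 2 * crossSum 0 as      ≡⟨ regroup a S (crossSum 0 as) ⟩
      2 * (a * S + crossSum 0 as)            ∎
      where
      open ≤-Reasoning
      S≤aS : S ≤ a * S
      S≤aS = ≤-trans (≤-reflexive (sym (*-identityˡ S))) (*-monoˡ-≤ S 1≤a)
      expand : ∀ l a S → suc l * (a + S) ≡ suc l * a + S + l * S
      expand = solve-∀
      regroup : ∀ a S w → S * a + a * S + 2 * w ≡ 2 * (a * S + w)
      regroup = solve-∀

  Pointwise-map : ∀ {A : Set} {f g : A → ℕ} {xs} → All (λ x → f x ≤ g x) xs → Pointwise _≤_ (map f xs) (map g xs)
  Pointwise-map [] = []
  Pointwise-map (fx≤gx ∷ fxs≤gxs) = fx≤gx ∷ Pointwise-map fxs≤gxs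


module DisjointPrefixes (B : ℕ) where

  open import Data.Nat
  open import Data.Nat.Properties
  open import Data.List using (List; []; _∷_; length)
  open import Data.List.Relation.Unary.All using (All; []; _∷_)
  open import Relation.Binary.PropositionalEquality
  open import Data.Nat.Tactic.RingSolver
  open FallingFactorial
  open CrossSum

  -- Permutations of B items whose first a entries avoid a fixed set of u items.
  avoiding : ℕ → ℕ → ℕ
  avoiding a u = fall (B ∸ u) a * (B ∸ a) !

  -- Tuples of permutations whose prefixes of lengths as are pairwise disjoint and avoid u fixed items.
  disjointPrefixes : ℕ → List ℕ → ℕ
  disjointPrefixes u [] = 1
  disjointPrefixes u (a ∷ as) = avoiding a u * disjointPrefixes (u + a) as

  avoiding-lowerBound : ∀ a u → a ≤ B → B * B ! ≤ B * avoiding a u + a * u * B !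
  avoiding-lowerBound a u a≤B = begin
    B * B !                                                            ≡⟨ cong (B *_) (sym (fall*!≡! B a a≤B)) ⟩
    B * (fall B a * (B ∸ a) !)                                         ≡⟨ sym (*-assoc B _ _) ⟩
    B * fall B a * (B ∸ a) !                                           ≤⟨ *-monoˡ-≤ ((B ∸ a) !) (fall-∸-lowerBound B a u) ⟩
    (B * fall (B ∸ u) a + a * u * fall B a) * (B ∸ a) !                ≡⟨ regroup B (fall (B ∸ u) a) (a * u) (fall B a) ((B ∸ a) !) ⟩
    B * (fall (B ∸ u) a * (B ∸ a) !) + a * u * (fall B a * (B ∸ a) !) ≡⟨ cong (λ z → B * avoiding a u + a * u * z) (fall*!≡! B a a≤B) ⟩
    B * avoiding a u + a * u * B !                                     ∎
    where
    open ≤-Reasoning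
    regroup : ∀ b x y z w → (b * x + y * z) * w ≡ b * (x * w) + y * (z * w)
    regroup = solve-∀

  avoiding-upperBound : ∀ a u → a ≤ B → avoiding a u * (B + a * u) ≤ B * B !
  avoiding-upperBound a u a≤B = begin
    fall (B ∸ u) a * (B ∸ a) ! * (B + a * u)   ≡⟨ regroup (fall (B ∸ u) a) ((B ∸ a) !) (B + a * u) ⟩
    (B ∸ a) ! * (fall (B ∸ u) a * (B + a * u)) ≤⟨ *-monoʳ-≤ ((B ∸ a) !) (fall-∸-upperBound B u a) ⟩
    (B ∸ a) ! * (B * fall B a)                 ≡⟨ regroup′ ((B ∸ a) !) B (fall B a) ⟩
    B * (fall B a * (B ∸ a) !)                 ≡⟨ cong (B *_) (fall*!≡! B a a≤B) ⟩
    B * B !                                    ∎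
    where
    open ≤-Reasoning
    regroup : ∀ x y z → x * y * z ≡ y * (x * z)
    regroup = solve-∀
    regroup′ : ∀ x y z → x * (y * z) ≡ y * (z * x)
    regroup′ = solve-∀

  avoiding≤! : ∀ a u → a ≤ B → avoiding a u ≤ B !
  avoiding≤! a u a≤B = ≤-trans (*-monoˡ-≤ ((B ∸ a) !) (fall-monoˡ-≤ a (m∸n≤m B u))) (≤-reflexive (fall*!≡! B a a≤B))

  -- With T = (B!)^|as| and W = crossSum u as, the two bounds below read 1 − W/B ≤ disjointPrefixes/T ≤ B/(B + W):
  -- a union bound over the instances, and ∏ B/(B + xᵢ) ≤ B/(B + Σ xᵢ).
  disjointPrefixes-lowerBound : ∀ u as → All (_≤ B) as →
                                B * (B !) ^ length as ≤ B * disjointPrefixes u as + (B !) ^ length as * crossSum u as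
  disjointPrefixes-lowerBound u [] [] = ≤-reflexive (sym (+-identityʳ (B * 1)))
  disjointPrefixes-lowerBound u (a ∷ as) (a≤B ∷ as≤B) = begin
    B * (B ! * T)                              ≡⟨ sym (*-assoc B (B !) T) ⟩
    B * B ! * T                                ≤⟨ *-monoˡ-≤ T (avoiding-lowerBound a u a≤B) ⟩
    (B * c + a * u * B !) * T                  ≡⟨ regroup₁ B c (a * u) (B !) T ⟩
    c * (B * T) + a * u * B ! * T              ≤⟨ +-monoˡ-≤ (a * u * B ! * T) (*-monoʳ-≤ c (disjointPrefixes-lowerBound (u + a) as as≤B)) ⟩
    c * (B * Q + T * W) + a * u * B ! * T      ≡⟨ regroup₂ B c Q T W (a * u) (B !) ⟩
    B * (c * Q) + c * T * W + a * u * B ! * T  ≤⟨ +-monoˡ-≤ (a * u * B ! * T) (+-monoʳ-≤ (B * (c * Q)) (*-monoˡ-≤ W cT≤B!T)) ⟩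
    B * (c * Q) + B ! * T * W + a * u * B ! * T ≡⟨ regroup₃ B (c * Q) (B !) T W (a * u) ⟩
    B * (c * Q) + B ! * T * (a * u + W)        ∎
    where
    open ≤-Reasoning
    c = avoiding a u
    T = (B !) ^ length as
    Q = disjointPrefixes (u + a) as
    W = crossSum (u + a) as
    cT≤B!T : c * T ≤ B ! * T
    cT≤B!T = *-monoˡ-≤ T (avoiding≤! a u a≤B)
    regroup₁ : ∀ b c y f t → (b * c + y * f) * t ≡ c * (b * t) + y * f * t
    regroup₁ = solve-∀
    regroup₂ : ∀ b c q t w y f → c * (b * q + t * w) + y * f * t ≡ b * (c * q) + c * t * w + y * f * t
    regroup₂ = solve-∀
    regroup₃ : ∀ b x f t w y → b * x + f * t * w + y * f * t ≡ b * x + f * t * (y + w)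
    regroup₃ = solve-∀

  disjointPrefixes-upperBound : ∀ u as → All (_≤ B) as → 1 ≤ B →
                                disjointPrefixes u as * (B + crossSum u as) ≤ B * (B !) ^ length as
  disjointPrefixes-upperBound u [] [] _ = ≤-reflexive (trans (+-identityʳ (B + 0)) (trans (+-identityʳ B) (sym (*-identityʳ B))))
  disjointPrefixes-upperBound u (a ∷ as) (a≤B ∷ as≤B) 1≤B = *-cancelˡ-≤ B {{>-nonZero 1≤B}} (begin
    B * (c * Q * (B + (a * u + W)))     ≡⟨ regroup₁ B c Q (a * u) W ⟩
    c * Q * (B * (B + (a * u + W)))     ≤⟨ *-monoʳ-≤ (c * Q) (m+n≤o⇒m≤o _ (≤-reflexive (regroup₂ B (a * u) W))) ⟩
    c * Q * ((B + a * u) * (B + W))     ≡⟨ regroup₃ c Q (B + a * u) (B + W) ⟩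
    (c * (B + a * u)) * (Q * (B + W))   ≤⟨ *-mono-≤ (avoiding-upperBound a u a≤B) (disjointPrefixes-upperBound (u + a) as as≤B 1≤B) ⟩
    (B * B !) * (B * T)                 ≡⟨ regroup₄ B (B !) T ⟩
    B * (B * (B ! * T))                 ∎)
    where
    open ≤-Reasoning
    c = avoiding a u
    T = (B !) ^ length as
    Q = disjointPrefixes (u + a) as
    W = crossSum (u + a) as
    regroup₁ : ∀ b c q y w → b * (c * q * (b + (y + w))) ≡ c * q * (b * (b + (y + w)))
    regroup₁ = solve-∀
    regroup₂ : ∀ b y w → b * (b + (y + w)) + y * w ≡ (b + y) * (b + w)
    regroup₂ = solve-∀
    regroup₃ : ∀ c q x y → c * q * (x * y) ≡ (c * x) * (q * y)
    regroup₃ = solve-∀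
    regroup₄ : ∀ b f t → (b * f) * (b * t) ≡ b * (b * (f * t))
    regroup₄ = solve-∀


module Disjointness where

  open import Data.Nat
  open import Data.Nat.Properties
  open import Data.Bool using (Bool; true; false; not; _∧_; _∨_; T)
  open import Data.Bool.Properties using (⇔→≡; ∧-identityʳ; ∧-zeroʳ)
  open import Data.Bool.ListAction using (all; any)
  open import Data.List using (List; []; _∷_; [_]; _++_; length; upTo)
  open import Data.List.Properties using (upTo-∷ʳ)
  open import Data.List.Relation.Unary.All as All using (All; []; _∷_)
  open import Data.List.Relation.Unary.All.Properties using (all-upTo)
  open import Data.List.Relation.Unary.Any using (here; there)
  open import Data.List.Relation.Unary.AllPairs using ([]; _∷_)
  open import Data.List.Relation.Unary.Unique.Propositional using (Unique)
  open import Data.List.Membership.Propositional using (_∈_)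
  open import Data.Empty using (⊥; ⊥-elim)
  open import Data.Sum using (_⊎_; inj₁; inj₂)
  open import Function using (_∘_; mk⇔)
  open import Relation.Binary.PropositionalEquality hiding ([_])
  open import Defs using (disjointᵇ; pairwiseDisjointᵇ)
  open Counting
  open import Data.Bool.Solver using (module ∨-∧-Solver)
  open ∨-∧-Solver using (solve; _:*_; _:=_)

  private variable
    A : Set

  ≡ᵇ⇒≡′ : ∀ {x y} → (x ≡ᵇ y) ≡ true → x ≡ y
  ≡ᵇ⇒≡′ {x} {y} e = ≡ᵇ⇒≡ x y (subst T (sym e) _)

  ≡ᵇ-refl : ∀ x → (x ≡ᵇ x) ≡ true
  ≡ᵇ-refl zero = refl
  ≡ᵇ-refl (suc x) = ≡ᵇ-refl x

  ≢⇒≡ᵇ≡false : ∀ {x y} → x ≢ y → (x ≡ᵇ y) ≡ false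
  ≢⇒≡ᵇ≡false {x} {y} x≢y with x ≡ᵇ y in eq
  ... | true = ⊥-elim (x≢y (≡ᵇ⇒≡′ eq))
  ... | false = refl

  _∈ᵇ_ : ℕ → List ℕ → Bool
  x ∈ᵇ ys = any (λ y → x ≡ᵇ y) ys

  ∈ᵇ⇒∈ : ∀ {x} ys → x ∈ᵇ ys ≡ true → x ∈ ys
  ∈ᵇ⇒∈ {x} (y ∷ ys) e with x ≡ᵇ y in eq
  ... | true = here (≡ᵇ⇒≡′ eq)
  ... | false = there (∈ᵇ⇒∈ ys e)

  ∈⇒∈ᵇ : ∀ {x ys} → x ∈ ys → x ∈ᵇ ys ≡ true
  ∈⇒∈ᵇ {x} (here refl) rewrite ≡ᵇ-refl x = refl
  ∈⇒∈ᵇ {x} {y ∷ _} (there p) rewrite ∈⇒∈ᵇ p with x ≡ᵇ y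
  ... | true = refl
  ... | false = refl

  ∈ᵇ-++ : ∀ x ys zs → x ∈ᵇ (ys ++ zs) ≡ x ∈ᵇ ys ∨ x ∈ᵇ zs
  ∈ᵇ-++ x [] zs = refl
  ∈ᵇ-++ x (y ∷ ys) zs rewrite ∈ᵇ-++ x ys zs with x ≡ᵇ y
  ... | true = refl
  ... | false = refl

  Disjoint : List ℕ → List ℕ → Set
  Disjoint xs ys = ∀ {x} → x ∈ xs → x ∈ ys → ⊥

  disjointᵇ⇒Disjoint : ∀ xs ys → disjointᵇ xs ys ≡ true → Disjoint xs ys
  disjointᵇ⇒Disjoint (x ∷ xs) ys e _ _ with x ∈ᵇ ys in x∈ᵇys
  disjointᵇ⇒Disjoint (x ∷ xs) ys () _ _ | true
  disjointᵇ⇒Disjoint (x ∷ xs) ys e (here refl) x∈ys | false with () ← trans (sym x∈ᵇys) (∈⇒∈ᵇ x∈ys)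
  disjointᵇ⇒Disjoint (x ∷ xs) ys e (there z∈xs) z∈ys | false = disjointᵇ⇒Disjoint xs ys e z∈xs z∈ys

  Disjoint⇒disjointᵇ : ∀ xs ys → Disjoint xs ys → disjointᵇ xs ys ≡ true
  Disjoint⇒disjointᵇ [] ys _ = refl
  Disjoint⇒disjointᵇ (x ∷ xs) ys disj with x ∈ᵇ ys in x∈ᵇys
  ... | true = ⊥-elim (disj (here refl) (∈ᵇ⇒∈ ys x∈ᵇys))
  ... | false = Disjoint⇒disjointᵇ xs ys (disj ∘ there)

  disjointᵇ-comm : ∀ xs ys → disjointᵇ xs ys ≡ disjointᵇ ys xs
  disjointᵇ-comm xs ys = ⇔→≡ (mk⇔ (λ e → Disjoint⇒disjointᵇ ys xs (λ p q → disjointᵇ⇒Disjoint xs ys e q p))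
                                 (λ e → Disjoint⇒disjointᵇ xs ys (λ p q → disjointᵇ⇒Disjoint ys xs e q p)))

  all-cong : {p q : A → Bool} → (∀ x → p x ≡ q x) → (xs : List A) → all p xs ≡ all q xs
  all-cong e [] = refl
  all-cong e (x ∷ xs) = cong₂ _∧_ (e x) (all-cong e xs)

  all-∧ : (p q : A → Bool) (xs : List A) → all (λ x → p x ∧ q x) xs ≡ all p xs ∧ all q xs
  all-∧ p q [] = refl
  all-∧ p q (x ∷ xs) rewrite all-∧ p q xs with p x | q x
  ... | true | true = refl
  ... | true | false = sym (∧-zeroʳ (all p xs))
  ... | false | _ = refl

  all-true : (xs : List A) → all (λ _ → true) xs ≡ true
  all-true [] = refl
  all-true (x ∷ xs) = all-true xs

  not-∨ : ∀ a b → not (a ∨ b) ≡ not a ∧ not b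
  not-∨ true b = refl
  not-∨ false b = refl

  disjointᵇ-++ : ∀ xs ys zs → disjointᵇ xs (ys ++ zs) ≡ disjointᵇ xs ys ∧ disjointᵇ xs zs
  disjointᵇ-++ xs ys zs =
    trans (all-cong (λ x → trans (cong not (∈ᵇ-++ x ys zs)) (not-∨ (x ∈ᵇ ys) (x ∈ᵇ zs))) xs)
          (all-∧ (λ x → not (x ∈ᵇ ys)) (λ x → not (x ∈ᵇ zs)) xs)

  pairwiseDisjointFromᵇ : List ℕ → List (List ℕ) → Bool
  pairwiseDisjointFromᵇ F o = pairwiseDisjointᵇ o ∧ all (λ x → disjointᵇ x F) o

  pairwiseDisjointFromᵇ-[] : ∀ o → pairwiseDisjointFromᵇ [] o ≡ pairwiseDisjointᵇ o
  pairwiseDisjointFromᵇ-[] o =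
    trans (cong (pairwiseDisjointᵇ o ∧_) (trans (all-cong (λ x → all-true x) o) (all-true o)))
          (∧-identityʳ (pairwiseDisjointᵇ o))

  pairwiseDisjointFromᵇ-∷ : ∀ F t o → pairwiseDisjointFromᵇ F (t ∷ o) ≡ disjointᵇ t F ∧ pairwiseDisjointFromᵇ (F ++ t) o
  pairwiseDisjointFromᵇ-∷ F t o = begin
    (all (disjointᵇ t) o ∧ pairwiseDisjointᵇ o) ∧ (disjointᵇ t F ∧ all (λ x → disjointᵇ x F) o)
      ≡⟨ rearrange (all (disjointᵇ t) o) (pairwiseDisjointᵇ o) (disjointᵇ t F) (all (λ x → disjointᵇ x F) o) ⟩
    disjointᵇ t F ∧ (pairwiseDisjointᵇ o ∧ (all (λ x → disjointᵇ x F) o ∧ all (disjointᵇ t) o))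
      ≡⟨ cong (λ z → disjointᵇ t F ∧ (pairwiseDisjointᵇ o ∧ z)) (sym all-split) ⟩
    disjointᵇ t F ∧ (pairwiseDisjointᵇ o ∧ all (λ x → disjointᵇ x (F ++ t)) o)
      ∎
    where
    open ≡-Reasoning
    split : ∀ x → disjointᵇ x (F ++ t) ≡ disjointᵇ x F ∧ disjointᵇ t x
    split x = trans (disjointᵇ-++ x F t) (cong (disjointᵇ x F ∧_) (disjointᵇ-comm x t))
    all-split : all (λ x → disjointᵇ x (F ++ t)) o ≡ all (λ x → disjointᵇ x F) o ∧ all (disjointᵇ t) o
    all-split = trans (all-cong split o) (all-∧ (λ x → disjointᵇ x F) (disjointᵇ t) o)
    rearrange : ∀ a p c d → (a ∧ p) ∧ (c ∧ d) ≡ c ∧ (p ∧ (d ∧ a))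
    rearrange = solve 4 (λ a p c d → (a :* p) :* (c :* d) := c :* (p :* (d :* a))) refl

  count-≡ᵇ-upTo : ∀ n x → x < n → count (λ y → y ≡ᵇ x) (upTo n) ≡ 1
  count-≡ᵇ-upTo (suc n) x x<1+n = trans (cong (count (λ y → y ≡ᵇ x)) (sym (upTo-∷ʳ n)))
    (trans (count-++ (λ y → y ≡ᵇ x) (upTo n) [ n ]) (last (m≤n⇒m<n∨m≡n (s≤s⁻¹ x<1+n))))
    where
    last : x < n ⊎ x ≡ n → count (λ y → y ≡ᵇ x) (upTo n) + (𝟙 (n ≡ᵇ x) + 0) ≡ 1
    last (inj₁ x<n) rewrite count-≡ᵇ-upTo n x x<n | ≢⇒≡ᵇ≡false {n} {x} (λ n≡x → <-irrefl (sym n≡x) x<n) = refl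
    last (inj₂ refl) rewrite ≡ᵇ-refl x
                           | count≡0 {p = λ y → y ≡ᵇ x} (All.map (λ y<x → ≢⇒≡ᵇ≡false (<⇒≢ y<x)) (all-upTo x)) = refl

  count-∈ᵇ-upTo : ∀ B t → Unique t → All (_< B) t → count (_∈ᵇ t) (upTo B) ≡ length t
  count-∈ᵇ-upTo B [] _ _ = count≡0 {xs = upTo B} (All.tabulate (λ _ → refl))
  count-∈ᵇ-upTo B (x ∷ t) (x∉t ∷ t-unique) (x<B ∷ t<B) =
    trans (count-∨ (λ y → y ≡ᵇ x) (_∈ᵇ t) (upTo B) (λ y y≡ᵇx → x∉ᵇt y (≡ᵇ⇒≡′ y≡ᵇx)))
          (cong₂ _+_ (count-≡ᵇ-upTo B x x<B) (count-∈ᵇ-upTo B t t-unique t<B))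
    where
    x∉ᵇt : ∀ y → y ≡ x → y ∈ᵇ t ≡ false
    x∉ᵇt y refl with y ∈ᵇ t in y∈ᵇt
    ... | true = ⊥-elim (All.lookup x∉t (∈ᵇ⇒∈ t y∈ᵇt) refl)
    ... | false = refl


module BinsLayout (m k′ : ℕ) where

  open import Data.Nat
  open import Data.Nat.Properties
  open import Data.Nat.DivMod
  open import Data.List using (List; []; _∷_; map; concatMap; _++_; take; length; upTo)
  open import Data.List.Properties using (length-map; length-upTo; ++-assoc)
  open import Data.List.Relation.Unary.Any using (here; there)
  open import Data.List.Membership.Propositional using (_∈_)
  open import Data.List.Membership.Propositional.Properties using (∈-upTo⁻; ∈-++⁻; ∈-++⁺ʳ; ∈-map⁻)
  open import Relation.Binary.PropositionalEquality
  open import Data.Product using (_×_; _,_; ∃)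
  open import Data.Sum using (_⊎_; inj₁; inj₂)
  open import Data.Nat.Tactic.RingSolver
  open import Defs using (binsSequence)

  k : ℕ
  k = suc k′

  B : ℕ
  B = m / k

  bin : ℕ → List ℕ
  bin b = map (λ j → b * k + j + 1) (upTo k)

  leftover : List ℕ
  leftover = map (λ j → B * k + j + 1) (upTo (m % k))

  ids : List ℕ → List ℕ
  ids = binsSequence m k

  ids-∷ : ∀ b σ → ids (b ∷ σ) ≡ bin b ++ ids σ
  ids-∷ b σ = ++-assoc (bin b) (concatMap bin σ) leftover

  binsNeeded : ℕ → ℕ
  binsNeeded d = (d + k′) / k

  -- Leftover IDs are treated as a partial bin with index B.
  InBin : ℕ → ℕ → Set
  InBin b x = ∃ λ j → j < k × x ≡ b * k + j + 1

  take-++ : ∀ {A : Set} n (xs ys : List A) → take n (xs ++ ys) ≡ take n xs ++ take (n ∸ length xs) ys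
  take-++ zero [] ys = refl
  take-++ zero (x ∷ xs) ys = refl
  take-++ (suc n) [] ys = refl
  take-++ (suc n) (x ∷ xs) ys = cong (x ∷_) (take-++ n xs ys)

  ∈-take : ∀ {A : Set} {x : A} n xs → x ∈ take n xs → x ∈ xs
  ∈-take (suc n) (y ∷ xs) (here x≡y) = here x≡y
  ∈-take (suc n) (y ∷ xs) (there x∈) = there (∈-take n xs x∈)

  ∈-take⇒1≤n : ∀ {A : Set} {x : A} n xs → x ∈ take n xs → 1 ≤ n
  ∈-take⇒1≤n (suc n) _ _ = s≤s z≤n

  length-bin : ∀ b → length (bin b) ≡ k
  length-bin b = trans (length-map _ (upTo k)) (length-upTo k)

  take-ids-∷ : ∀ d b σ → take d (ids (b ∷ σ)) ≡ take d (bin b) ++ take (d ∸ k) (ids σ)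
  take-ids-∷ d b σ = begin
    take d (ids (b ∷ σ))                                   ≡⟨ cong (take d) (ids-∷ b σ) ⟩
    take d (bin b ++ ids σ)                                ≡⟨ take-++ d (bin b) (ids σ) ⟩
    take d (bin b) ++ take (d ∸ length (bin b)) (ids σ)   ≡⟨ cong (λ l → take d (bin b) ++ take (d ∸ l) (ids σ)) (length-bin b) ⟩
    take d (bin b) ++ take (d ∸ k) (ids σ)                 ∎
    where open ≡-Reasoning

  binsNeeded-+k : ∀ d → binsNeeded (d + k) ≡ suc (binsNeeded d)
  binsNeeded-+k d = trans (m/n≡1+[m∸n]/n {d + k + k′} {k} (≤-trans (m≤n+m k d) (m≤m+n (d + k) k′)))
                          (cong (λ z → suc (z / k)) cancel)
    where
    cancel : d + k + k′ ∸ k ≡ d + k′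
    cancel = trans (cong (_∸ k) (swap d k k′)) (m+n∸n≡m (d + k′) k)
      where
      swap : ∀ d k k′ → d + k + k′ ≡ d + k′ + k
      swap = solve-∀

  binsNeeded-suc : ∀ d → binsNeeded (suc d) ≡ suc (d / k)
  binsNeeded-suc d = trans (m/n≡1+[m∸n]/n {suc d + k′} {k} (s≤s (m≤n+m k′ d))) (cong (λ z → suc (z / k)) (m+n∸n≡m d k′))

  binsNeeded-bounds : ∀ d → d ≤ binsNeeded d * k × binsNeeded d * k ≤ d + k′
  binsNeeded-bounds d = lower , upper
    where
    c = binsNeeded d
    split : d + k′ ≡ (d + k′) % k + c * k
    split = m≡m%n+[m/n]*n (d + k′) k
    upper : c * k ≤ d + k′
    upper = subst (c * k ≤_) (sym split) (m≤n+m (c * k) _)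
    lower : d ≤ c * k
    lower = +-cancelʳ-≤ k′ d (c * k) (s≤s⁻¹ (subst (d + k′ <_) (cong suc (+-comm k′ (c * k)))
              (subst (_< k + c * k) (sym split) (+-monoˡ-< (c * k) (m%n<n (d + k′) k)))))

  ∈-bin : ∀ {b x} → x ∈ bin b → InBin b x
  ∈-bin {b} x∈ with ∈-map⁻ (λ j → b * k + j + 1) x∈
  ... | j , j∈ , x≡ = j , ∈-upTo⁻ j∈ , x≡

  ∈-leftover : ∀ {x} → x ∈ leftover → InBin B x
  ∈-leftover x∈ with ∈-map⁻ (λ j → B * k + j + 1) x∈
  ... | j , j∈ , x≡ = j , <-trans (∈-upTo⁻ j∈) (m%n<n m k) , x≡

  bin-index : ∀ b j → j < k → (b * k + j) / k ≡ b
  bin-index b j j<k = begin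
    (b * k + j) / k      ≡⟨ /-congˡ (+-comm (b * k) j) ⟩
    (j + b * k) / k      ≡⟨ +-distrib-/ j (b * k) no-carry ⟩
    j / k + b * k / k    ≡⟨ cong₂ _+_ (m<n⇒m/n≡0 j<k) (m*n/n≡m b k) ⟩
    b                    ∎
    where
    open ≡-Reasoning
    no-carry : j % k + b * k % k < k
    no-carry = subst (_< k) (sym (trans (cong₂ _+_ (m<n⇒m%n≡m j<k) (m*n%n≡0 b k)) (+-identityʳ j))) j<k

  InBin-injective : ∀ {b b′ x} → InBin b x → InBin b′ x → b ≡ b′
  InBin-injective {b} {b′} (j , j<k , refl) (j′ , j′<k , eq) =
    trans (sym (bin-index b j j<k)) (trans (cong (_/ k) (+-cancelʳ-≡ 1 _ _ eq)) (bin-index b′ j′ j′<k))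

  ∸+≡ : ∀ d → 1 ≤ d ∸ k → d ∸ k + k ≡ d
  ∸+≡ d 1≤d∸k = m∸n+n≡m {d} {k} (<⇒≤ (m∸n≢0⇒n<m (λ d∸k≡0 → <⇒≢ 1≤d∸k (sym d∸k≡0))))

  binsNeeded-∸k : ∀ d → 1 ≤ suc d ∸ k → d / k ≡ binsNeeded (suc d ∸ k)
  binsNeeded-∸k d 1≤e = suc-injective (begin
    suc (d / k)                     ≡⟨ sym (binsNeeded-suc d) ⟩
    binsNeeded (suc d)              ≡⟨ cong binsNeeded (sym (∸+≡ (suc d) 1≤e)) ⟩
    binsNeeded (suc d ∸ k + k)      ≡⟨ binsNeeded-+k (suc d ∸ k) ⟩
    suc (binsNeeded (suc d ∸ k))    ∎)
    where open ≡-Reasoning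

  ∈-take-ids : ∀ σ d {x} → x ∈ take d (ids σ) →
               (∃ λ b → b ∈ take (binsNeeded d) σ × InBin b x) ⊎ (x ∈ leftover × length σ * k < d)
  ∈-take-ids [] (suc d) x∈ = inj₂ (∈-take (suc d) leftover x∈ , s≤s z≤n)
  ∈-take-ids (b ∷ σ) (suc d) {x} x∈ rewrite binsNeeded-suc d
    with ∈-++⁻ (take (suc d) (bin b)) (subst (x ∈_) (take-ids-∷ (suc d) b σ) x∈)
  ... | inj₁ x∈bin = inj₁ (b , here refl , ∈-bin {b} (∈-take (suc d) (bin b) x∈bin))
  ... | inj₂ x∈rest with 1≤e ← ∈-take⇒1≤n (suc d ∸ k) (ids σ) x∈rest with ∈-take-ids σ (suc d ∸ k) x∈rest
  ... | inj₁ (b′ , b′∈ , x∈b′) = inj₁ (b′ , there (subst (λ c → b′ ∈ take c σ) (sym (binsNeeded-∸k d 1≤e)) b′∈) , x∈b′)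
  ... | inj₂ (x∈leftover , σk<e) =
    inj₂ (x∈leftover , subst (k + length σ * k <_) (trans (+-comm k (suc d ∸ k)) (∸+≡ (suc d) 1≤e)) (+-monoʳ-< k σk<e))

  binStart : ℕ → ℕ
  binStart b = b * k + 0 + 1

  binStart-∈-take-ids : ∀ σ d {b} → 1 ≤ d → b ∈ take (binsNeeded d) σ → binStart b ∈ take d (ids σ)
  binStart-∈-take-ids [] (suc d) _ b∈ with () ← ∈-take (binsNeeded (suc d)) [] b∈
  binStart-∈-take-ids (b₀ ∷ σ) (suc d) {b} _ b∈ rewrite binsNeeded-suc d | take-ids-∷ (suc d) b₀ σ with b∈
  ... | here refl = here refl
  ... | there b∈σ with suc d ∸ k in e
  ... | zero with () ← subst (λ c → b ∈ take c σ) (m<n⇒m/n≡0 {d} {k} (m∸n≡0⇒m≤n e)) b∈σ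
  ... | suc e′ = ∈-++⁺ʳ (take (suc d) (bin b₀)) (binStart-∈-take-ids σ (suc e′) (s≤s z≤n) b∈rest)
    where
    b∈rest : b ∈ take (binsNeeded (suc e′)) σ
    b∈rest = subst (λ c → b ∈ take c σ) (trans (binsNeeded-∸k d (subst (1 ≤_) (sym e) (s≤s z≤n))) (cong binsNeeded e)) b∈σ


module CollisionFree (m k′ : ℕ) where

  open import Data.Nat
  open import Data.Nat.Properties
  open import Data.Nat.ListAction using (sum)
  open import Data.Bool using (Bool; true; false; not; _∨_)
  open import Data.Bool.Properties using (⇔→≡; not-involutive)
  open import Data.List using (List; []; _∷_; map; concatMap; _++_; take; length; upTo)
  open import Data.List.Properties using (length-upTo; length-take; take-all; map-cong; map-cong-local; map-∘)
  open import Data.List.Relation.Unary.All as All using (All; []; _∷_)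
  import Data.List.Relation.Unary.All.Properties as All
  import Data.List.Relation.Unary.Unique.Propositional.Properties as Unique
  open import Data.List.Membership.Propositional using (_∈_)
  open import Data.List.Membership.Propositional.Properties using (∈-++⁻; ∈-++⁺ˡ; ∈-++⁺ʳ)
  open import Data.Product using (_×_; _,_; proj₁; ∃)
  open import Data.Sum using (_⊎_; inj₁; inj₂)
  open import Data.Empty using (⊥-elim)
  open import Function using (mk⇔)
  open import Relation.Binary.PropositionalEquality
  open import Defs using (disjointᵇ; runs; Bins; permutations)
  open Counting
  open FallingFactorial
  open Permutations
  open Disjointness
  open BinsLayout m k′

  -- F: IDs handed out so far; β: bins opened so far. Leftover IDs (the partial bin B) are only
  -- handed out once every bin has been opened.
  record Tracks (F β : List ℕ) : Set where
    field
      issued⇒opened  : ∀ {y} → y ∈ F → ∃ λ b → InBin b y × (b ∈ β ⊎ (B ≤ b × (∀ {b′} → b′ < B → b′ ∈ β)))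
      opened⇒started : ∀ {b} → b ∈ β → binStart b ∈ F
      opened<B       : ∀ {b} → b ∈ β → b < B
  open Tracks

  Tracks-[] : Tracks [] []
  Tracks-[] = record { issued⇒opened = λ () ; opened⇒started = λ () ; opened<B = λ () }

  binsUsed : ℕ → ℕ
  binsUsed d = binsNeeded d ⊓ B

  take-⊓-length : ∀ {A : Set} n (xs : List A) → take n xs ≡ take (n ⊓ length xs) xs
  take-⊓-length zero xs = refl
  take-⊓-length (suc n) [] = refl
  take-⊓-length (suc n) (x ∷ xs) = cong (x ∷_) (take-⊓-length n xs)

  module Step (1≤B : 1 ≤ B) (σ : List ℕ) (σ-perm : IsPermutationOfUpTo B σ) (d : ℕ) (1≤d : 1 ≤ d) where
    open IsPermutationOfUpTo σ-perm

    issued opened : List ℕ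
    issued = take d (ids σ)
    opened = take (binsNeeded d) σ

    opened-all : length σ * k < d → ∀ {b} → b ∈ σ → b ∈ opened
    opened-all σk<d = subst (_ ∈_) (sym (take-all (binsNeeded d) σ (<⇒≤ σ<binsNeeded)))
      where
      σ<binsNeeded : length σ < binsNeeded d
      σ<binsNeeded = *-cancelʳ-< k (length σ) (binsNeeded d) (<-≤-trans σk<d (proj₁ (binsNeeded-bounds d)))

    opened≡take-binsUsed : opened ≡ take (binsUsed d) σ
    opened≡take-binsUsed = trans (take-⊓-length (binsNeeded d) σ) (cong (λ n → take (binsNeeded d ⊓ n) σ) length≡)

    opened<B′ : ∀ {b} → b ∈ opened → b < B
    opened<B′ b∈ = ∈⇒< (∈-take (binsNeeded d) σ b∈)

    module _ {F β} (T : Tracks F β) where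

      disjoint-issued⇒disjoint-opened : Disjoint issued F → Disjoint opened β
      disjoint-issued⇒disjoint-opened disj b∈opened b∈β =
        disj (binStart-∈-take-ids σ d 1≤d b∈opened) (opened⇒started T b∈β)

      disjoint-opened⇒disjoint-issued : Disjoint opened β → Disjoint issued F
      disjoint-opened⇒disjoint-issued disj x∈issued x∈F with issued⇒opened T x∈F
      ... | b′ , x∈b′ , where-b′ with ∈-take-ids σ d x∈issued
      ... | inj₁ (b , b∈opened , x∈b) with refl ← InBin-injective {b} {b′} x∈b x∈b′ with where-b′
      ...   | inj₁ b∈β = disj b∈opened b∈β
      ...   | inj₂ (B≤b , _) = <⇒≱ (opened<B′ b∈opened) B≤b
      disjoint-opened⇒disjoint-issued disj x∈issued x∈F | b′ , x∈b′ , where-b′ | inj₂ (x∈leftover , σk<d)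
        with refl ← InBin-injective {B} {b′} (∈-leftover x∈leftover) x∈b′ with where-b′
      ...   | inj₁ B∈β = <-irrefl refl (opened<B T B∈β)
      ...   | inj₂ (_ , all-opened) = disj (opened-all σk<d (<⇒∈ 1≤B)) (all-opened 1≤B)

      disjointᵇ-issued≡disjointᵇ-opened : disjointᵇ issued F ≡ disjointᵇ opened β
      disjointᵇ-issued≡disjointᵇ-opened = ⇔→≡ (mk⇔
        (λ e → Disjoint⇒disjointᵇ opened β (disjoint-issued⇒disjoint-opened (disjointᵇ⇒Disjoint issued F e)))
        (λ e → Disjoint⇒disjointᵇ issued F (disjoint-opened⇒disjoint-issued (disjointᵇ⇒Disjoint opened β e))))

      Tracks-++ : Tracks (F ++ issued) (β ++ opened)
      issued⇒opened Tracks-++ y∈ with ∈-++⁻ F y∈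
      ... | inj₁ y∈F with issued⇒opened T y∈F
      ...   | b , y∈b , inj₁ b∈β = b , y∈b , inj₁ (∈-++⁺ˡ b∈β)
      ...   | b , y∈b , inj₂ (B≤b , all-opened) = b , y∈b , inj₂ (B≤b , λ b′<B → ∈-++⁺ˡ (all-opened b′<B))
      issued⇒opened Tracks-++ y∈ | inj₂ y∈issued with ∈-take-ids σ d y∈issued
      ... | inj₁ (b , b∈opened , y∈b) = b , y∈b , inj₁ (∈-++⁺ʳ β b∈opened)
      ... | inj₂ (y∈leftover , σk<d) = B , ∈-leftover y∈leftover , inj₂ (≤-refl , λ b′<B → ∈-++⁺ʳ β (opened-all σk<d (<⇒∈ b′<B)))
      opened⇒started Tracks-++ b∈ with ∈-++⁻ β b∈
      ... | inj₁ b∈β = ∈-++⁺ˡ (opened⇒started T b∈β)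
      ... | inj₂ b∈opened = ∈-++⁺ʳ F (binStart-∈-take-ids σ d 1≤d b∈opened)
      opened<B Tracks-++ b∈ with ∈-++⁻ β b∈
      ... | inj₁ b∈β = opened<B T b∈β
      ... | inj₂ b∈opened = opened<B′ b∈opened

    count-opened-++ : ∀ {β} → Disjoint opened β →
                      count (_∈ᵇ (β ++ opened)) (upTo B) ≡ count (_∈ᵇ β) (upTo B) + binsUsed d
    count-opened-++ {β} disj = begin
      count (_∈ᵇ (β ++ opened)) (upTo B)                          ≡⟨ count-cong (λ y → ∈ᵇ-++ y β opened) (upTo B) ⟩
      count (λ y → y ∈ᵇ β ∨ y ∈ᵇ opened) (upTo B)                 ≡⟨ count-∨ (_∈ᵇ β) (_∈ᵇ opened) (upTo B) exclusive ⟩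
      count (_∈ᵇ β) (upTo B) + count (_∈ᵇ opened) (upTo B)        ≡⟨ cong (count (_∈ᵇ β) (upTo B) +_) opened-count ⟩
      count (_∈ᵇ β) (upTo B) + binsUsed d                         ∎
      where
      open ≡-Reasoning
      exclusive : ∀ y → y ∈ᵇ β ≡ true → y ∈ᵇ opened ≡ false
      exclusive y y∈ᵇβ with y ∈ᵇ opened in y∈ᵇopened
      ... | true = ⊥-elim (disj (∈ᵇ⇒∈ {y} opened y∈ᵇopened) (∈ᵇ⇒∈ {y} β y∈ᵇβ))
      ... | false = refl
      opened-count : count (_∈ᵇ opened) (upTo B) ≡ binsUsed d
      opened-count = trans (count-∈ᵇ-upTo B opened (Unique.take⁺ (binsNeeded d) unique) (All.take⁺ (binsNeeded d) (All.tabulate ∈⇒<)))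
                           (trans (length-take (binsNeeded d) σ) (cong (binsNeeded d ⊓_) length≡))

  open DisjointPrefixes B using (avoiding; disjointPrefixes)
  open PrefixCount using (prefixAll; countPrefixAll; countPrefixAll≡; forbidden)

  collisionFreeFrom : List ℕ → List ℕ → ℕ
  collisionFreeFrom F D = count (pairwiseDisjointFromᵇ F) (runs (Bins m k) D)

  collisionFreeFrom-∷ : ∀ F d D → collisionFreeFrom F (d ∷ D)
    ≡ sum (map (λ σ → 𝟙 (disjointᵇ (take d (ids σ)) F) * collisionFreeFrom (F ++ take d (ids σ)) D) (permutations (upTo B)))
  collisionFreeFrom-∷ F d D = begin
    count (pairwiseDisjointFromᵇ F) (concatMap (λ s → map (take d s ∷_) (runs (Bins m k) D)) (Bins m k))
      ≡⟨ count-concatMap (pairwiseDisjointFromᵇ F) _ (Bins m k) ⟩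
    sum (map (λ s → count (pairwiseDisjointFromᵇ F) (map (take d s ∷_) (runs (Bins m k) D))) (map ids (permutations (upTo B))))
      ≡⟨ cong sum (sym (map-∘ (permutations (upTo B)))) ⟩
    sum (map (λ σ → count (pairwiseDisjointFromᵇ F) (map (take d (ids σ) ∷_) (runs (Bins m k) D))) (permutations (upTo B)))
      ≡⟨ cong sum (map-cong step (permutations (upTo B))) ⟩
    sum (map (λ σ → 𝟙 (disjointᵇ (take d (ids σ)) F) * collisionFreeFrom (F ++ take d (ids σ)) D) (permutations (upTo B)))
      ∎
    where
    open ≡-Reasoning
    step : ∀ σ → count (pairwiseDisjointFromᵇ F) (map (take d (ids σ) ∷_) (runs (Bins m k) D))
               ≡ 𝟙 (disjointᵇ (take d (ids σ)) F) * collisionFreeFrom (F ++ take d (ids σ)) D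
    step σ = trans (count-map (pairwiseDisjointFromᵇ F) (t ∷_) (runs (Bins m k) D))
             (trans (count-cong (pairwiseDisjointFromᵇ-∷ F t) (runs (Bins m k) D))
                    (count-const-∧ (disjointᵇ t F) (pairwiseDisjointFromᵇ (F ++ t)) (runs (Bins m k) D)))
      where t = take d (ids σ)

  openedCount : List ℕ → ℕ
  openedCount β = count (_∈ᵇ β) (upTo B)

  countPrefixAll-avoiding : ∀ β a → a ≤ B → countPrefixAll (λ x → not (x ∈ᵇ β)) (upTo B) a ≡ avoiding a (openedCount β)
  countPrefixAll-avoiding β a a≤B = begin
    countPrefixAll q (upTo B) a
      ≡⟨ countPrefixAll≡ q (upTo B) a (subst (a ≤_) (sym (length-upTo B)) a≤B) ⟩
    fall (length (upTo B) ∸ forbidden q (upTo B)) a * (length (upTo B) ∸ a) !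
      ≡⟨ cong₂ (λ L v → fall (L ∸ v) a * (L ∸ a) !) (length-upTo B) (count-cong (λ y → not-involutive (y ∈ᵇ β)) (upTo B)) ⟩
    avoiding a (openedCount β)
      ∎
    where
    open ≡-Reasoning
    q : ℕ → Bool
    q x = not (x ∈ᵇ β)

  collisionFreeFrom≡ : 1 ≤ B → ∀ D {F β} → Tracks F β → All (1 ≤_) D →
                       collisionFreeFrom F D ≡ disjointPrefixes (openedCount β) (map binsUsed D)
  collisionFreeFrom≡ 1≤B [] T [] = refl
  collisionFreeFrom≡ 1≤B (d ∷ D) {F} {β} T (1≤d ∷ 1≤D) = begin
    collisionFreeFrom F (d ∷ D)
      ≡⟨ collisionFreeFrom-∷ F d D ⟩
    sum (map (λ σ → 𝟙 (disjointᵇ (take d (ids σ)) F) * collisionFreeFrom (F ++ take d (ids σ)) D) perms)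
      ≡⟨ cong sum (map-cong-local (All.map per-permutation (permutations-upTo B))) ⟩
    sum (map (λ σ → 𝟙 (prefixAll q a σ) * rest) perms)
      ≡⟨ sum-map-𝟙* (prefixAll q a) rest perms ⟩
    countPrefixAll q (upTo B) a * rest
      ≡⟨ cong (_* rest) (countPrefixAll-avoiding β a (m⊓n≤n (binsNeeded d) B)) ⟩
    avoiding a u * rest
      ∎
    where
    open ≡-Reasoning
    perms = permutations (upTo B)
    a = binsUsed d
    u = openedCount β
    rest = disjointPrefixes (u + a) (map binsUsed D)
    q : ℕ → Bool
    q x = not (x ∈ᵇ β)

    per-permutation : ∀ {σ} → IsPermutationOfUpTo B σ →
      𝟙 (disjointᵇ (take d (ids σ)) F) * collisionFreeFrom (F ++ take d (ids σ)) D ≡ 𝟙 (prefixAll q a σ) * rest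
    per-permutation {σ} σ-perm = proof
      where
      open Step 1≤B σ σ-perm d 1≤d
      proof : 𝟙 (disjointᵇ issued F) * collisionFreeFrom (F ++ issued) D ≡ 𝟙 (prefixAll q a σ) * rest
      proof rewrite disjointᵇ-issued≡disjointᵇ-opened T | opened≡take-binsUsed with prefixAll q a σ in opened-fresh
      ... | true = cong (1 *_) (trans (collisionFreeFrom≡ 1≤B D (Tracks-++ T) 1≤D)
                                      (cong (λ v → disjointPrefixes v (map binsUsed D)) (count-opened-++ disj)))
        where
        disj : Disjoint opened β
        disj = disjointᵇ⇒Disjoint opened β (trans (cong (λ l → disjointᵇ l β) opened≡take-binsUsed) opened-fresh)
      ... | false = refl


module Weight (k : ℕ) where

  open import Data.Nat
  open import Data.Nat.Properties
  open import Data.Nat.ListAction using (sum)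
  open import Data.List using (List; map; length)
  open import Data.List.Properties using (length-map; map-∘; map-id)
  open import Data.List.Relation.Binary.Pointwise using (Pointwise)
  open import Data.List.Relation.Unary.All as All using (All)
  import Data.List.Relation.Unary.All.Properties as All
  open import Relation.Binary.PropositionalEquality
  open import Data.Nat.Tactic.RingSolver
  open CrossSum

  -- k·m times the quantity X of the theorem, for n instances with demands D.
  weight : ℕ → List ℕ → ℕ
  weight n D = (sum D * sum D ∸ sumOfSquares D) + k * (n * sum D) + k * (n * n * k)

  sum²∸sumOfSquares : ∀ D → sum D * sum D ∸ sumOfSquares D ≡ 2 * crossSum 0 D
  sum²∸sumOfSquares D = trans (cong (_∸ sumOfSquares D) (square-sum 0 D)) (m+n∸m≡n (sumOfSquares D) (2 * crossSum 0 D))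

  crossSum-map-k* : ∀ as → crossSum 0 (map (k *_) as) ≡ k * k * crossSum 0 as
  crossSum-map-k* as = trans (cong (λ u → crossSum u (map (k *_) as)) (sym (*-zeroʳ k))) (crossSum-scale k 0 as)

  weight≡ : ∀ n D → weight n D ≡ 2 * crossSum 0 D + k * (n * sum D) + k * (n * n * k)
  weight≡ n D = cong (λ z → z + k * (n * sum D) + k * (n * n * k)) (sum²∸sumOfSquares D)

  weight-upperBound : ∀ (f : ℕ → ℕ) → (∀ d → k * f d ≤ d + k) → ∀ D → k * k * crossSum 0 (map f D) ≤ weight (length D) D
  weight-upperBound f rounded D = begin
    k * k * crossSum 0 (map f D)      ≡⟨ sym (crossSum-map-k* (map f D)) ⟩
    crossSum 0 (map (k *_) (map f D)) ≡⟨ cong (crossSum 0) (sym (map-∘ D)) ⟩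
    crossSum 0 (map (λ d → k * f d) D) ≤⟨ crossSum-mono (Pointwise-map {xs = D} (All.tabulate (λ {d} _ → rounded d))) ≤-refl ⟩
    crossSum 0 E                      ≤⟨ *-cancelˡ-≤ 2 (+-cancelʳ-≤ s₂ _ _ doubled) ⟩
    weight n D                        ∎
    where
    open ≤-Reasoning
    n = length D
    s₁ = sum D
    s₂ = sumOfSquares D
    W = crossSum 0 D
    E = map (_+ k) D
    doubled : 2 * crossSum 0 E + s₂ ≤ 2 * weight n D + s₂
    doubled = begin
      2 * crossSum 0 E + s₂                              ≤⟨ +-monoʳ-≤ (2 * crossSum 0 E) (sumOfSquares-map-+ k D) ⟩
      2 * crossSum 0 E + sumOfSquares E                  ≡⟨ +-comm (2 * crossSum 0 E) _ ⟩
      sumOfSquares E + 2 * crossSum 0 E                  ≡⟨ sym (square-sum 0 E) ⟩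
      sum E * sum E                                      ≡⟨ cong (λ z → z * z) (sum-map-+ k D) ⟩
      (s₁ + n * k) * (s₁ + n * k)                        ≡⟨ expand s₁ (n * k) ⟩
      s₁ * s₁ + 2 * (n * k * s₁) + n * k * (n * k)       ≡⟨ cong (λ z → z + 2 * (n * k * s₁) + n * k * (n * k)) (square-sum 0 D) ⟩
      s₂ + 2 * W + 2 * (n * k * s₁) + n * k * (n * k)    ≤⟨ m+n≤o⇒m≤o _ (≤-reflexive (regroup s₂ W n k s₁)) ⟩
      2 * (2 * W + k * (n * s₁) + k * (n * n * k)) + s₂  ≡⟨ cong (λ z → 2 * z + s₂) (sym (weight≡ n D)) ⟩
      2 * weight n D + s₂                                ∎
      where
      expand : ∀ s x → (s + x) * (s + x) ≡ s * s + 2 * (x * s) + x * x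
      expand = solve-∀
      regroup : ∀ s w n k t → s + 2 * w + 2 * (n * k * t) + n * k * (n * k) + (2 * w + n * k * (n * k))
                              ≡ 2 * (2 * w + k * (n * t) + k * (n * n * k)) + s
      regroup = solve-∀

  weight-lowerBound : ∀ (f : ℕ → ℕ) D → All (λ d → d ≤ k * f d) D → All (λ d → 1 ≤ f d) D → 2 ≤ length D →
                      weight (length D) D ≤ 10 * (k * k * crossSum 0 (map f D))
  weight-lowerBound f D covered 1≤f 2≤n = begin
    weight n D
      ≡⟨ weight≡ n D ⟩
    2 * W + k * (n * s₁) + k * (n * n * k)
      ≤⟨ +-mono-≤ (+-mono-≤ (*-monoʳ-≤ 2 W≤) (*-monoʳ-≤ k (*-monoʳ-≤ n s₁≤))) (*-monoʳ-≤ k (*-monoˡ-≤ k n²≤)) ⟩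
    2 * (k * k * Wa) + k * (n * (k * Sa)) + k * (4 * Wa * k)
      ≡⟨ cong (λ z → 2 * (k * k * Wa) + z + k * (4 * Wa * k)) (exchange k n Sa) ⟩
    2 * (k * k * Wa) + k * k * (n * Sa) + k * (4 * Wa * k)
      ≤⟨ +-monoˡ-≤ (k * (4 * Wa * k)) (+-monoʳ-≤ (2 * (k * k * Wa)) (*-monoʳ-≤ (k * k) nSa≤)) ⟩
    2 * (k * k * Wa) + k * k * (4 * Wa) + k * (4 * Wa * k)
      ≡⟨ collect k Wa ⟩
    10 * (k * k * Wa)
      ∎
    where
    open ≤-Reasoning
    n = length D
    s₁ = sum D
    W = crossSum 0 D
    as = map f D
    Wa = crossSum 0 as
    Sa = sum as
    n≡ : length as ≡ n
    n≡ = length-map f D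
    1≤as : All (1 ≤_) as
    1≤as = All.map⁺ 1≤f
    D≤kas : Pointwise _≤_ D (map (k *_) as)
    D≤kas = subst₂ (Pointwise _≤_) (map-id D) (map-∘ D) (Pointwise-map covered)
    W≤ : W ≤ k * k * Wa
    W≤ = ≤-trans (crossSum-mono D≤kas ≤-refl) (≤-reflexive (crossSum-map-k* as))
    s₁≤ : s₁ ≤ k * Sa
    s₁≤ = ≤-trans (sum-mono D≤kas) (≤-reflexive (sum-map-*ˡ k as))
    n≤2[n∸1] : ∀ n → 2 ≤ n → n ≤ 2 * (n ∸ 1)
    n≤2[n∸1] (suc zero) (s≤s ())
    n≤2[n∸1] (suc (suc n′)) _ = m+n≤o⇒m≤o _ (≤-reflexive (double n′))
      where
      double : ∀ n′ → suc (suc n′) + n′ ≡ 2 * suc n′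
      double = solve-∀
    nSa≤ : n * Sa ≤ 4 * Wa
    nSa≤ = begin
      n * Sa               ≤⟨ *-monoˡ-≤ Sa (n≤2[n∸1] n 2≤n) ⟩
      2 * (n ∸ 1) * Sa     ≡⟨ *-assoc 2 (n ∸ 1) Sa ⟩
      2 * ((n ∸ 1) * Sa)   ≤⟨ *-monoʳ-≤ 2 (subst (λ ℓ → (ℓ ∸ 1) * Sa ≤ 2 * Wa) n≡ ([length∸1]*sum≤2*crossSum as 1≤as)) ⟩
      2 * (2 * Wa)         ≡⟨ sym (*-assoc 2 2 Wa) ⟩
      4 * Wa               ∎
    n²≤ : n * n ≤ 4 * Wa
    n²≤ = ≤-trans (*-monoʳ-≤ n (subst (_≤ Sa) n≡ (length≤sum as 1≤as))) nSa≤
    exchange : ∀ k n s → k * (n * (k * s)) ≡ k * k * (n * s)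
    exchange = solve-∀
    collect : ∀ k w → 2 * (k * k * w) + k * k * (4 * w) + k * (4 * w * k) ≡ 10 * (k * k * w)
    collect = solve-∀


module CollisionBounds (m′ k′ : ℕ) where

  open import Data.Nat
  open import Data.Nat.Properties
  open import Data.Nat.DivMod
  open import Data.Nat.ListAction using (sum)
  open import Data.Bool using (not)
  open import Data.List using (List; []; _∷_; map; concatMap; take; length; upTo)
  open import Data.List.Properties using (length-map; length-upTo; map-cong)
  open import Data.List.Relation.Unary.All as All using (All; []; _∷_)
  import Data.List.Relation.Unary.All.Properties as All
  open import Data.Sum using (_⊎_; inj₁; inj₂)
  open import Data.Product using (proj₁; proj₂)
  open import Data.Empty using (⊥-elim)
  open import Relation.Nullary using (yes; no)
  open import Relation.Binary.PropositionalEquality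
  open import Data.Nat.Tactic.RingSolver
  open import Defs using (runs; pairwiseDisjointᵇ; collisionCount; Bins; permutations)
  open Counting
  open CrossSum
  open Permutations using (length-permutations)
  open Disjointness using (pairwiseDisjointFromᵇ-[])
  open BinsLayout (suc m′) k′
  open CollisionFree (suc m′) k′
  open DisjointPrefixes B
  open Weight k

  m : ℕ
  m = suc m′

  length-runs : ∀ (A : List (List ℕ)) D → length (runs A D) ≡ length A ^ length D
  length-runs A [] = refl
  length-runs A (d ∷ D) = begin
    length (concatMap (λ s → map (take d s ∷_) (runs A D)) A)          ≡⟨ length-concatMap _ A ⟩
    sum (map (λ s → length (map (take d s ∷_) (runs A D))) A)          ≡⟨ cong sum (map-cong length-branch A) ⟩
    sum (map (λ _ → length A ^ length D) A)                            ≡⟨ sum-map-const (length A ^ length D) A ⟩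
    length A * length A ^ length D                                     ∎
    where
    open ≡-Reasoning
    length-branch : ∀ s → length (map (take d s ∷_) (runs A D)) ≡ length A ^ length D
    length-branch s = trans (length-map _ (runs A D)) (length-runs A D)

  length-Bins : length (Bins m k) ≡ B !
  length-Bins = trans (length-map ids (permutations (upTo B))) (trans (length-permutations (upTo B)) (cong _! (length-upTo B)))

  module _ (k≤m : k ≤ m) where

    1≤B : 1 ≤ B
    1≤B = subst (1 ≤_) (sym (m/n≡1+[m∸n]/n {m} {k} k≤m)) (s≤s z≤n)

    Bk≤m : B * k ≤ m
    Bk≤m = subst (B * k ≤_) (sym (m≡m%n+[m/n]*n m k)) (m≤n+m (B * k) (m % k))

    m≤2Bk : m ≤ 2 * B * k
    m≤2Bk = subst (_≤ 2 * B * k) (sym (m≡m%n+[m/n]*n m k))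
      (≤-trans (+-monoˡ-≤ (B * k) (<⇒≤ (<-≤-trans (m%n<n m k) k≤Bk))) (≤-reflexive (double B k)))
      where
      k≤Bk : k ≤ B * k
      k≤Bk = ≤-trans (≤-reflexive (sym (*-identityˡ k))) (*-monoˡ-≤ k 1≤B)
      double : ∀ x k → x * k + x * k ≡ 2 * x * k
      double = solve-∀

    module Profile (D : List ℕ) (n : ℕ) (length-D : length D ≡ n) (1≤D : All (1 ≤_) D) (2≤n : 2 ≤ n) where

      as : List ℕ
      as = map binsUsed D

      W collisions free outcomes : ℕ
      W = crossSum 0 as
      collisions = collisionCount (Bins m k) D
      free = disjointPrefixes 0 as
      outcomes = length (Bins m k) ^ n

      length-as : length as ≡ n
      length-as = trans (length-map binsUsed D) length-D

      as≤B : All (_≤ B) as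
      as≤B = All.map⁺ (All.tabulate (λ {d} _ → m⊓n≤n (binsNeeded d) B))

      outcomes≡ : outcomes ≡ (B !) ^ length as
      outcomes≡ = cong₂ _^_ length-Bins (sym length-as)

      1≤outcomes : 1 ≤ outcomes
      1≤outcomes = subst (λ T → 1 ≤ T ^ n) (sym length-Bins) (m^n>0 (B !) {{B !≢0}} n)

      collisions+free≡outcomes : collisions + free ≡ outcomes
      collisions+free≡outcomes = begin
        collisions + free
          ≡⟨ cong₂ _+_ (length-filter (λ o → not (pairwiseDisjointᵇ o)) (runs (Bins m k) D)) (sym free≡) ⟩
        count (λ o → not (pairwiseDisjointᵇ o)) (runs (Bins m k) D) + count pairwiseDisjointᵇ (runs (Bins m k) D)
          ≡⟨ count-not+count pairwiseDisjointᵇ (runs (Bins m k) D) ⟩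
        length (runs (Bins m k) D)
          ≡⟨ trans (length-runs (Bins m k) D) (cong (length (Bins m k) ^_) length-D) ⟩
        outcomes
          ∎
        where
        open ≡-Reasoning
        free≡ : count pairwiseDisjointᵇ (runs (Bins m k) D) ≡ free
        free≡ = trans (count-cong (λ o → sym (pairwiseDisjointFromᵇ-[] o)) (runs (Bins m k) D))
                (trans (collisionFreeFrom≡ 1≤B D Tracks-[] 1≤D)
                       (cong (λ u → disjointPrefixes u as) (count≡0 {xs = upTo B} (All.tabulate (λ _ → refl)))))

      B*collisions≤outcomes*W : B * collisions ≤ outcomes * W
      B*collisions≤outcomes*W = +-cancelʳ-≤ (B * free) (B * collisions) (outcomes * W) (begin
        B * collisions + B * free       ≡⟨ sym (*-distribˡ-+ B collisions free) ⟩
        B * (collisions + free)         ≡⟨ cong (B *_) (trans collisions+free≡outcomes outcomes≡) ⟩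
        B * (B !) ^ length as           ≤⟨ disjointPrefixes-lowerBound 0 as as≤B ⟩
        B * free + (B !) ^ length as * W ≡⟨ +-comm (B * free) _ ⟩
        (B !) ^ length as * W + B * free ≡⟨ cong (λ T → T * W + B * free) (sym outcomes≡) ⟩
        outcomes * W + B * free         ∎)
        where open ≤-Reasoning

      outcomes*W≤collisions*[B+W] : outcomes * W ≤ collisions * (B + W)
      outcomes*W≤collisions*[B+W] = +-cancelʳ-≤ (B * outcomes) (outcomes * W) (collisions * (B + W)) (begin
        outcomes * W + B * outcomes                      ≡⟨ factor outcomes W B ⟩
        outcomes * (B + W)                               ≡⟨ cong (_* (B + W)) (sym collisions+free≡outcomes) ⟩
        (collisions + free) * (B + W)                    ≡⟨ *-distribʳ-+ (B + W) collisions free ⟩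
        collisions * (B + W) + free * (B + W)            ≤⟨ +-monoʳ-≤ (collisions * (B + W)) free*[B+W]≤ ⟩
        collisions * (B + W) + B * outcomes              ∎)
        where
        open ≤-Reasoning
        factor : ∀ T W B → T * W + B * T ≡ T * (B + W)
        factor = solve-∀
        free*[B+W]≤ : free * (B + W) ≤ B * outcomes
        free*[B+W]≤ = subst (λ T → free * (B + W) ≤ B * T) (sym outcomes≡) (disjointPrefixes-upperBound 0 as as≤B 1≤B)

      k²W≤weight : k * k * W ≤ weight n D
      k²W≤weight = subst (λ ℓ → k * k * W ≤ weight ℓ D) length-D (weight-upperBound binsUsed rounded D)
        where
        rounded : ∀ d → k * binsUsed d ≤ d + k
        rounded d = begin
          k * binsUsed d      ≤⟨ *-monoʳ-≤ k (m⊓n≤m (binsNeeded d) B) ⟩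
          k * binsNeeded d    ≡⟨ *-comm k (binsNeeded d) ⟩
          binsNeeded d * k    ≤⟨ proj₂ (binsNeeded-bounds d) ⟩
          d + k′              ≤⟨ +-monoʳ-≤ d (n≤1+n k′) ⟩
          d + k               ∎
          where open ≤-Reasoning

      weight≤10k²W : W < B → weight n D ≤ 10 * (k * k * W)
      weight≤10k²W W<B = subst (λ ℓ → weight ℓ D ≤ 10 * (k * k * W)) length-D
        (weight-lowerBound binsUsed D (All.map covered (All.map⁻ (All-≤-crossSum as 1≤as 2≤length-as)))
                                      (All.map⁻ 1≤as) (subst (2 ≤_) (sym length-D) 2≤n))
        where
        1≤binsUsed : ∀ {d} → 1 ≤ d → 1 ≤ binsUsed d
        1≤binsUsed {suc d} _ = ⊓-glb (subst (1 ≤_) (sym (binsNeeded-suc d)) (s≤s z≤n)) 1≤B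
        1≤as : All (1 ≤_) as
        1≤as = All.map⁺ (All.map 1≤binsUsed 1≤D)
        2≤length-as : 2 ≤ length as
        2≤length-as = subst (2 ≤_) (sym length-as) 2≤n
        covered : ∀ {d} → binsUsed d ≤ W → d ≤ k * binsUsed d
        covered {d} used≤W with binsNeeded d ≤? B
        ... | yes needed≤B rewrite m≤n⇒m⊓n≡m needed≤B = ≤-trans (proj₁ (binsNeeded-bounds d)) (≤-reflexive (*-comm (binsNeeded d) k))
        ... | no needed≰B = ⊥-elim (<⇒≱ W<B (subst (_≤ W) (m≥n⇒m⊓n≡n (<⇒≤ (≰⇒> needed≰B))) used≤W))

      collisions≤outcomes : collisions ≤ outcomes
      collisions≤outcomes = subst (collisions ≤_) collisions+free≡outcomes (m≤m+n collisions free)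

      collisions-upperBound : collisions * (k * m) ≤ 2 * weight n D * outcomes
      collisions-upperBound = begin
        collisions * (k * m)                ≤⟨ *-monoʳ-≤ collisions (*-monoʳ-≤ k m≤2Bk) ⟩
        collisions * (k * (2 * B * k))      ≡⟨ regroup₁ collisions k B ⟩
        2 * k * k * (B * collisions)        ≤⟨ *-monoʳ-≤ (2 * k * k) B*collisions≤outcomes*W ⟩
        2 * k * k * (outcomes * W)          ≡⟨ regroup₂ k outcomes W ⟩
        2 * outcomes * (k * k * W)          ≤⟨ *-monoʳ-≤ (2 * outcomes) k²W≤weight ⟩
        2 * outcomes * weight n D           ≡⟨ regroup₃ outcomes (weight n D) ⟩
        2 * weight n D * outcomes           ∎
        where
        open ≤-Reasoning
        regroup₁ : ∀ N k B → N * (k * (2 * B * k)) ≡ 2 * k * k * (B * N)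
        regroup₁ = solve-∀
        regroup₂ : ∀ k T W → 2 * k * k * (T * W) ≡ 2 * T * (k * k * W)
        regroup₂ = solve-∀
        regroup₃ : ∀ T Z → 2 * T * Z ≡ 2 * Z * T
        regroup₃ = solve-∀

      -- When W ≥ B the collision probability is at least 1/2; otherwise it is comparable to W/B.
      collisions-lowerBound : outcomes ≤ 2 * collisions ⊎ weight n D * outcomes ≤ 20 * collisions * (k * m)
      collisions-lowerBound with B ≤? W
      ... | yes B≤W = inj₁ (*-cancelʳ-≤ outcomes (2 * collisions) W {{>-nonZero (≤-trans 1≤B B≤W)}} (begin
        outcomes * W             ≤⟨ outcomes*W≤collisions*[B+W] ⟩
        collisions * (B + W)     ≤⟨ *-monoʳ-≤ collisions (+-monoˡ-≤ W B≤W) ⟩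
        collisions * (W + W)     ≡⟨ regroup collisions W ⟩
        2 * collisions * W       ∎))
        where
        open ≤-Reasoning
        regroup : ∀ N W → N * (W + W) ≡ 2 * N * W
        regroup = solve-∀
      ... | no B≰W = inj₂ (begin
        weight n D * outcomes                ≤⟨ *-monoˡ-≤ outcomes (weight≤10k²W W<B) ⟩
        10 * (k * k * W) * outcomes          ≡⟨ regroup₁ k W outcomes ⟩
        10 * (k * k) * (outcomes * W)        ≤⟨ *-monoʳ-≤ (10 * (k * k)) outcomes*W≤collisions*[B+B] ⟩
        10 * (k * k) * (collisions * (B + B)) ≡⟨ regroup₂ k collisions B ⟩
        20 * collisions * k * (B * k)        ≤⟨ *-monoʳ-≤ (20 * collisions * k) Bk≤m ⟩
        20 * collisions * k * m              ≡⟨ *-assoc (20 * collisions) k m ⟩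
        20 * collisions * (k * m)            ∎)
        where
        open ≤-Reasoning
        W<B : W < B
        W<B = ≰⇒> B≰W
        outcomes*W≤collisions*[B+B] : outcomes * W ≤ collisions * (B + B)
        outcomes*W≤collisions*[B+B] = ≤-trans outcomes*W≤collisions*[B+W] (*-monoʳ-≤ collisions (+-monoʳ-≤ B (<⇒≤ W<B)))
        regroup₁ : ∀ k W T → 10 * (k * k * W) * T ≡ 10 * (k * k) * (T * W)
        regroup₁ = solve-∀
        regroup₂ : ∀ k N B → 10 * (k * k) * (N * (B + B)) ≡ 20 * N * k * (B * k)
        regroup₂ = solve-∀


module Fractions where

  open import Data.Nat as ℕ using (ℕ; suc; z≤n; s≤s)
  open import Data.Nat.Properties as ℕ using (*-mono-≤; *-monoˡ-≤; ≤-trans; ≤-reflexive; *-cancelʳ-≤; *-identityˡ; *-identityʳ; *-comm; m≤n*m)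
  open import Data.Integer as ℤ using (+_; +≤+)
  open import Data.Integer.Properties using (pos-*; pos-+)
  open import Data.Rational as ℚ using (ℚ; 1ℚ; toℚᵘ)
  open import Data.Rational.Properties as ℚ using (toℚᵘ-fromℚᵘ; toℚᵘ-homo-+; toℚᵘ-homo-*; toℚᵘ-injective; toℚᵘ-cancel-≤; toℚᵘ-mono-≤)
  open import Data.Rational.Unnormalised as ℚᵘ using (mkℚᵘ; *≤*)
  open import Data.Rational.Unnormalised.Properties as ℚᵘ using (≃-trans; ≃-sym; ≃-reflexive; ≤-respˡ-≃; ≤-respʳ-≃)
  open import Data.Product using (_×_; _,_)
  open import Data.Sum using (_⊎_; inj₁; inj₂; [_,_]′)
  open import Relation.Binary.PropositionalEquality
  open import Data.Nat.Tactic.RingSolver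
  open import Function using (id)
  open import Defs using (frac)

  private
    2≤20 : 2 ℕ.≤ 20
    2≤20 = s≤s (s≤s z≤n)

    toℚᵘ-frac : ∀ a b → toℚᵘ (frac a (suc b)) ℚᵘ.≃ mkℚᵘ (+ a) b
    toℚᵘ-frac a b = toℚᵘ-fromℚᵘ (mkℚᵘ (+ a) b)

  frac-+ : ∀ a b c d → 1 ℕ.≤ b → 1 ℕ.≤ d → frac a b ℚ.+ frac c d ≡ frac (a ℕ.* d ℕ.+ c ℕ.* b) (b ℕ.* d)
  frac-+ a (suc b) c (suc d) _ _ = toℚᵘ-injective (≃-trans (toℚᵘ-homo-+ (frac a (suc b)) (frac c (suc d)))
    (≃-trans (ℚᵘ.+-cong (toℚᵘ-frac a b) (toℚᵘ-frac c d)) (≃-trans (≃-reflexive unnormalised) (≃-sym (toℚᵘ-frac _ _)))))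
    where
    unnormalised : mkℚᵘ (+ a) b ℚᵘ.+ mkℚᵘ (+ c) d ≡ mkℚᵘ (+ (a ℕ.* suc d ℕ.+ c ℕ.* suc b)) (d ℕ.+ b ℕ.* suc d)
    unnormalised = cong (λ z → mkℚᵘ z (d ℕ.+ b ℕ.* suc d))
      (trans (cong₂ ℤ._+_ (sym (pos-* a (suc d))) (sym (pos-* c (suc b)))) (sym (pos-+ (a ℕ.* suc d) (c ℕ.* suc b))))

  frac-* : ∀ c a b → 1 ℕ.≤ b → frac c 1 ℚ.* frac a b ≡ frac (c ℕ.* a) b
  frac-* c a (suc b) _ = toℚᵘ-injective (≃-trans (toℚᵘ-homo-* (frac c 1) (frac a (suc b)))
    (≃-trans (ℚᵘ.*-cong (toℚᵘ-frac c 0) (toℚᵘ-frac a b)) (≃-trans (≃-reflexive unnormalised) (≃-sym (toℚᵘ-frac _ _)))))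
    where
    unnormalised : mkℚᵘ (+ c) 0 ℚᵘ.* mkℚᵘ (+ a) b ≡ mkℚᵘ (+ (c ℕ.* a)) b
    unnormalised = cong₂ mkℚᵘ (sym (pos-* c a)) (ℕ.+-identityʳ b)

  frac-mono-≤ : ∀ a b c d → 1 ℕ.≤ b → 1 ℕ.≤ d → a ℕ.* d ℕ.≤ c ℕ.* b → frac a b ℚ.≤ frac c d
  frac-mono-≤ a (suc b) c (suc d) _ _ ad≤cb = toℚᵘ-cancel-≤ (≤-respˡ-≃ (≃-sym (toℚᵘ-frac a b)) (≤-respʳ-≃ (≃-sym (toℚᵘ-frac c d))
    (*≤* (subst₂ ℤ._≤_ (pos-* a (suc d)) (pos-* c (suc b)) (+≤+ ad≤cb)))))

  frac-cancel-≤ : ∀ a b c d → 1 ℕ.≤ b → 1 ℕ.≤ d → frac a b ℚ.≤ frac c d → a ℕ.* d ℕ.≤ c ℕ.* b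
  frac-cancel-≤ a (suc b) c (suc d) _ _ a/b≤c/d
    with *≤* ad≤cb ← ≤-respˡ-≃ (toℚᵘ-frac a b) (≤-respʳ-≃ (toℚᵘ-frac c d) (toℚᵘ-mono-≤ a/b≤c/d))
    with +≤+ r ← subst₂ ℤ._≤_ (sym (pos-* a (suc d))) (sym (pos-* c (suc b))) ad≤cb = r

  frac-cong : ∀ a b c d → 1 ℕ.≤ b → 1 ℕ.≤ d → a ℕ.* d ≡ c ℕ.* b → frac a b ≡ frac c d
  frac-cong a b c d 1≤b 1≤d ad≡cb =
    ℚ.≤-antisym (frac-mono-≤ a b c d 1≤b 1≤d (≤-reflexive ad≡cb)) (frac-mono-≤ c d a b 1≤d 1≤b (≤-reflexive (sym ad≡cb)))

  frac-+-+ : ∀ E A C k m → 1 ℕ.≤ k → 1 ℕ.≤ m →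
             (frac E (k ℕ.* m) ℚ.+ frac A m) ℚ.+ frac C m ≡ frac (E ℕ.+ k ℕ.* A ℕ.+ k ℕ.* C) (k ℕ.* m)
  frac-+-+ E A C k m 1≤k 1≤m =
    trans (cong (ℚ._+ frac C m) (frac-+ E (k ℕ.* m) A m 1≤km 1≤m))
    (trans (frac-+ (E ℕ.* m ℕ.+ A ℕ.* (k ℕ.* m)) (k ℕ.* m ℕ.* m) C m (*-mono-≤ 1≤km 1≤m) 1≤m)
           (frac-cong _ _ _ _ (*-mono-≤ (*-mono-≤ 1≤km 1≤m) 1≤m) 1≤km (identity E A C k m)))
    where
    1≤km = *-mono-≤ 1≤k 1≤m
    identity : ∀ E A C k m → ((E ℕ.* m ℕ.+ A ℕ.* (k ℕ.* m)) ℕ.* m ℕ.+ C ℕ.* (k ℕ.* m ℕ.* m)) ℕ.* (k ℕ.* m)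
                             ≡ (E ℕ.+ k ℕ.* A ℕ.+ k ℕ.* C) ℕ.* (k ℕ.* m ℕ.* m ℕ.* m)
    identity = solve-∀

  Θ-min : ∀ {X} N T Z K → X ≡ frac Z K → 1 ℕ.≤ T → 1 ℕ.≤ K → N ℕ.≤ T → N ℕ.* K ℕ.≤ 2 ℕ.* Z ℕ.* T →
          T ℕ.≤ 2 ℕ.* N ⊎ Z ℕ.* T ℕ.≤ 20 ℕ.* N ℕ.* K →
          (frac N T ℚ.≤ frac 20 1 ℚ.* (1ℚ ℚ.⊓ X)) × ((1ℚ ℚ.⊓ X) ℚ.≤ frac 20 1 ℚ.* frac N T)
  Θ-min N T Z K refl 1≤T 1≤K N≤T upper lower with ℚ.≤-total 1ℚ (frac Z K)
  ... | inj₁ 1≤Z/K rewrite ℚ.p≤q⇒p⊓q≡p 1≤Z/K | frac-* 20 1 1 (s≤s z≤n) | frac-* 20 N T 1≤T =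
    frac-mono-≤ N T 20 1 1≤T (s≤s z≤n) (≤-trans (≤-reflexive (*-identityʳ N)) (≤-trans N≤T (m≤n*m T 20))) ,
    frac-mono-≤ 1 1 (20 ℕ.* N) T (s≤s z≤n) 1≤T
      (≤-trans (≤-reflexive (*-identityˡ T)) (≤-trans T≤20N (≤-reflexive (sym (*-identityʳ (20 ℕ.* N))))))
    where
    K≤Z : K ℕ.≤ Z
    K≤Z = ≤-trans (≤-reflexive (sym (*-identityˡ K))) (≤-trans (frac-cancel-≤ 1 1 Z K (s≤s z≤n) 1≤K 1≤Z/K) (≤-reflexive (*-identityʳ Z)))
    T≤20N : T ℕ.≤ 20 ℕ.* N
    T≤20N = [ (λ T≤2N → ≤-trans T≤2N (*-monoˡ-≤ N 2≤20))
            , (λ ZT≤20NK → *-cancelʳ-≤ T (20 ℕ.* N) K {{ℕ.>-nonZero 1≤K}}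
                             (≤-trans (≤-reflexive (*-comm T K)) (≤-trans (*-monoˡ-≤ T K≤Z) ZT≤20NK)))
            ]′ lower
  ... | inj₂ Z/K≤1 rewrite ℚ.p≥q⇒p⊓q≡q Z/K≤1 | frac-* 20 Z K 1≤K | frac-* 20 N T 1≤T =
    frac-mono-≤ N T (20 ℕ.* Z) K 1≤T 1≤K (≤-trans upper (*-monoˡ-≤ T (*-monoˡ-≤ Z 2≤20))) ,
    frac-mono-≤ Z K (20 ℕ.* N) T 1≤K 1≤T (
      [ (λ T≤2N → ≤-trans (*-mono-≤ Z≤K T≤2N) (≤-trans (≤-reflexive (*-comm K (2 ℕ.* N))) (*-monoˡ-≤ K (*-monoˡ-≤ N 2≤20))))
      , id
      ]′ lower)
    where
    Z≤K : Z ℕ.≤ K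
    Z≤K = ≤-trans (≤-reflexive (sym (*-identityʳ Z))) (≤-trans (frac-cancel-≤ Z K 1 1 1≤K (s≤s z≤n) Z/K≤1) (≤-reflexive (*-identityˡ K)))


open import Defs
open import Data.Nat as ℕ using (ℕ; _≤_; _∸_; NonZero)
open import Data.Vec using (Vec)
open import Data.Vec.Relation.Unary.All using (All)
open import Data.Product using (Σ; _×_)
open import Data.Rational as ℚ using (ℚ; 1ℚ)

open import Data.Nat using (zero; suc; z≤n; s≤s)
open import Data.Product using (_,_; proj₁)
open import Data.Vec using (toList)
open import Data.Vec.Properties using (length-toList)
import Data.List.Relation.Unary.All as List
open import Data.Vec.Relation.Unary.All.Properties using (toList⁺)
open Fractions

theorem3p2 : Σ ℕ λ c → (1 ≤ c) ×
    ((m n k : ℕ) → .{{_ : NonZero k}} → (D : Vec ℕ n) →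
      2 ≤ n → All (λ d → 1 ≤ d × d ≤ m) D → 1 ≤ k → k ≤ m →
      let X = ℚ._+_ (ℚ._+_ (frac (norm1 D ℕ.* norm1 D ∸ norm2sq D) (k ℕ.* m))
                            (frac (n ℕ.* norm1 D) m))
                     (frac (n ℕ.* n ℕ.* k) m)
          p = collisionProb (Bins m k) D
      in (p ℚ.≤ ℚ._*_ (frac c 1) (1ℚ ℚ.⊓ X))
       × ((1ℚ ℚ.⊓ X) ℚ.≤ ℚ._*_ (frac c 1) p))
theorem3p2 = 20 , s≤s z≤n , λ where
  zero n (suc k′) D _ _ _ ()
  (suc m′) n (suc k′) D 2≤n D-bounds _ k≤m →
    let open CollisionBounds m′ k′
        open Profile k≤m (toList D) n (length-toList D) (List.map proj₁ (toList⁺ D-bounds)) 2≤n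
        open Weight (suc k′) using (weight)
        s = norm1 D
        X≡weight/km = frac-+-+ (s ℕ.* s ∸ norm2sq D) (n ℕ.* s) (n ℕ.* n ℕ.* suc k′) (suc k′) (suc m′) (s≤s z≤n) (s≤s z≤n)
    in Θ-min collisions outcomes (weight n (toList D)) (suc k′ ℕ.* suc m′) X≡weight/km
         1≤outcomes (s≤s z≤n) collisions≤outcomes collisions-upperBound collisions-lowerBound
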